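{- Let $q=p^f>5$, $p$ odd, $\omega$ a primitive element of $GF(q)$, and $T\cong PSL(2,q)$ the stabilizer in $PGL(3,q)$ of the conic $X_0X_2-X_1^2=0$. Let $\alpha,\beta$ be represented by $\mathrm{diag}(\omega,1,\omega^{ -1})$ and $\begin{pmatrix}0&0&1\\0&-1&0\\1&0&0\end{pmatrix}$, and $H_0=\langle\alpha^2,\beta\rangle$. For $c\in GF(q)$ let $\gamma_c$ be represented by $\begin{pmatrix}1&c&c^2\\0&1&2c\\0&0&1\end{pmatrix}$, and for $\xi\in GF(q)^*$ (with $\xi^2\neq-1$ when $q\equiv1\pmod4$) let $\tau_\xi$ be represented by $\begin{pmatrix}1&\xi&\xi^2\\2\xi&\xi^2-1&-2\xi\\ \xi^2&-\xi&1\end{pmatrix}$. Then for all $c,c_1,c_2\in GF(q)$ and integers $u,u_1,u_2$: (i) if $H_0\gamma_{c_1}=H_0\gamma_{c_2}$ then $c_1=c_2$; (ii) $H_0\gamma_{c_1}\neq H_0\tau_\xi\gamma_{c_2}\alpha^{2u}$; (iii) if $H_0\tau_\xi\gamma_{c_1}\alpha^{2u_1}=H_0\tau_\xi\gamma_{c_2}\alpha^{2u_2}$ and $(c_2,\alpha^{2u_2})\neq(c_1,\alpha^{2u_1})$, then $q\equiv1\pmod4$, $c_2=\xi^{ -1}-\xi-c_1$ and $\alpha^{2u_2}=\alpha^{2(u_1+\frac{q-1}{4})}$; (iv) if $q\equiv1\pmod4$, $\xi_1\neq\xi_2$ are as $\xi$ above, and $H_0\tau_{\xi_1}\gamma_{c_1}\alpha^{2u_1}=H_0\tau_{\xi_2}\gamma_{c_2}\alpha^{2u_2}$,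 then $\xi_1\xi_2$ is a nonzero square in $GF(q)$.
   Context: All these elements lie in $T$; $H_0$ is dihedral of order $q-1$ and $W=\{\gamma_c\}$ is the Sylow $p$-subgroup of $T$ fixing $(0,0,1)$. -}

module Defs where

open import Data.Nat as ℕ using (ℕ; zero; suc)
open import Data.Integer as ℤ using (ℤ; +_; -[1+_])
open import Data.Fin using (Fin; zero; suc)
open import Data.Product using (Σ; ∃; _×_; _,_)
open import Relation.Nullary using (¬_)
open import Relation.Binary.PropositionalEquality using (_≡_)
open import Algebra.Structures using (IsCommutativeRing)
open import Function.Bundles using (_↔_)

-- A finite field with exactly q elements (equality is propositional).
-- _⁻¹ is a total function; only its values on nonzero elements matter.
record FiniteField (q : ℕ) : Set₁ where
  infixl 6 _+_
  infixl 7 _*_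
  field
    Carrier  : Set
    _+_ _*_  : Carrier → Carrier → Carrier
    -_       : Carrier → Carrier
    0# 1#    : Carrier
    isCommutativeRing : IsCommutativeRing _≡_ _+_ _*_ -_ 0# 1#
    0≢1      : ¬ (0# ≡ 1#)
    _⁻¹      : Carrier → Carrier
    inverseʳ : ∀ x → ¬ (x ≡ 0#) → x * (x ⁻¹) ≡ 1#
    enumeration : Carrier ↔ Fin q

module Setup {q : ℕ} (F : FiniteField q) (ω : FiniteField.Carrier F) where
  open FiniteField F public

  _^_ : Carrier → ℕ → Carrier
  x ^ zero = 1#
  x ^ suc n = x * (x ^ n)

  IsPrimitive : Set
  IsPrimitive = ¬ (ω ≡ 0#) × (∀ x → ¬ (x ≡ 0#) → ∃ λ k → x ≡ ω ^ k)

  2# : Carrier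
  2# = 1# + 1#

  IsNonzeroSquare : Carrier → Set
  IsNonzeroSquare x = ¬ (x ≡ 0#) × ∃ λ y → x ≡ y * y

  Mat : Set
  Mat = Fin 3 → Fin 3 → Carrier

  mat3 : Carrier → Carrier → Carrier →
         Carrier → Carrier → Carrier →
         Carrier → Carrier → Carrier → Mat
  mat3 a b c d e f g h i zero zero = a
  mat3 a b c d e f g h i zero (suc zero) = b
  mat3 a b c d e f g h i zero (suc (suc zero)) = c
  mat3 a b c d e f g h i (suc zero) zero = d
  mat3 a b c d e f g h i (suc zero) (suc zero) = e
  mat3 a b c d e f g h i (suc zero) (suc (suc zero)) = f
  mat3 a b c d e f g h i (suc (suc zero)) zero = g
  mat3 a b c d e f g h i (suc (suc zero)) (suc zero) = h
  mat3 a b c d e f g h i (suc (suc zero)) (suc (suc zero)) = i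

  infixl 7 _·_
  _·_ : Mat → Mat → Mat
  (M · N) i j = M i zero * N zero j + M i (suc zero) * N (suc zero) j
                + M i (suc (suc zero)) * N (suc (suc zero)) j

  I₃ : Mat
  I₃ = mat3 1# 0# 0# 0# 1# 0# 0# 0# 1#

  matPow : Mat → ℕ → Mat
  matPow M zero = I₃
  matPow M (suc n) = M · matPow M n

  -- equality in PGL(3,q): matrices equal up to a nonzero scalar
  infix 4 _≃_
  _≃_ : Mat → Mat → Set
  M ≃ N = Σ Carrier λ l → ¬ (l ≡ 0#) × (∀ i j → M i j ≡ l * N i j)

  α : Mat
  α = mat3 ω 0# 0# 0# 1# 0# 0# 0# (ω ⁻¹)

  α⁻¹ : Mat
  α⁻¹ = mat3 (ω ⁻¹) 0# 0# 0# 1# 0# 0# 0# ω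

  αpow : ℤ → Mat
  αpow (+ n) = matPow α n
  αpow -[1+ n ] = matPow α⁻¹ (suc n)

  β : Mat
  β = mat3 0# 0# 1# 0# (- 1#) 0# 1# 0# 0#

  γ : Carrier → Mat
  γ c = mat3 1# c (c * c) 0# 1# (2# * c) 0# 0# 1#

  τ : Carrier → Mat
  τ ξ = mat3 1# ξ (ξ * ξ)
             (2# * ξ) (ξ * ξ + - 1#) (- (2# * ξ))
             (ξ * ξ) (- ξ) 1#

  -- H₀ = ⟨α², β⟩ : the subgroup of PGL(3,q) generated by α² and β,
  -- i.e. all words in α², (α²)⁻¹ = α⁻², β (= β⁻¹), closed under ≃.
  data InH₀ : Mat → Set where
    h-id  : InH₀ I₃
    h-α²  : ∀ {M} → InH₀ M → InH₀ (αpow (+ 2) · M)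
    h-α⁻² : ∀ {M} → InH₀ M → InH₀ (αpow (ℤ.- (+ 2)) · M)
    h-β   : ∀ {M} → InH₀ M → InH₀ (β · M)
    h-≃   : ∀ {M N} → InH₀ M → M ≃ N → InH₀ N

  _∈H₀·_ : Mat → Mat → Set
  x ∈H₀· g = ∃ λ M → InH₀ M × (x ≃ M · g)

  infix 4 _≡ᶜ_
  _≡ᶜ_ : Mat → Mat → Set
  g ≡ᶜ h = ∀ x → ((x ∈H₀· g) → (x ∈H₀· h)) × ((x ∈H₀· h) → (x ∈H₀· g))

  Admissible : Carrier → Set
  Admissible ξ = ¬ (ξ ≡ 0#) × (q ℕ.% 4 ≡ 1 → ¬ (ξ * ξ ≡ - 1#))

{-# OPTIONS --safe #-}
-- Every element of H₀ = ⟨α², β⟩ is, up to a scalar, diag(w², 1, w⁻²) or β · diag(w², 1, w⁻²).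
-- So H₀ x = H₀ y makes each row i of x a multiple of row i of y (a rotation) or of row 2 − i
-- (a reflection), with multipliers of that special shape. Comparing the first two columns of
-- γ_c and of τ_ξ γ_c α^(2u) turns this into linear equations. For two τ-cosets with the same ξ a
-- rotation forces all multipliers to be 1, because ξ(ξ² + 1) ≠ 0, and a reflection forces the
-- middle one to be −1: then −1 = ω^(2u₁) / ω^(2u₂) is a square, so q ≡ 1 (mod 4), and the other
-- equations give c₂ and α^(2u₂). In (iv) the multipliers exhibit ξ₁ξ₂ as w² or as
-- −w² = (ω^((q−1)/4) w)². All facts about q come from ω having order exactly q − 1 (pigeonhole
-- on its powers), so that ω^((q−1)/2) = −1 ≠ 1 and −1 is a square only if 4 ∣ q − 1.
module Submission where

open import Defs
open import Data.Nat as ℕ using (ℕ; zero; suc; _<_; _≤_; _∸_; _%_; _/_; z≤n; s≤s)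
import Data.Nat.Properties as ℕ
import Data.Nat.DivMod as DivMod
open import Data.Nat.Divisibility as Div using (_∣_)
open import Data.Nat.Tactic.RingSolver using (solve-∀)
open import Data.Nat.Primality using (Prime)
open import Data.Integer as ℤ using (ℤ; +_; -[1+_]; _⊖_)
import Data.Integer.Properties as ℤ
open import Data.Fin using (Fin; zero; suc; opposite; punchIn; punchOut; toℕ; fromℕ<)
import Data.Fin.Properties as Finₚ
open import Data.Vec.Functional using ([]; _∷_)
open import Data.Maybe using (Maybe; just; nothing)
open import Data.Product using (_×_; _,_; proj₁; proj₂)
open import Data.Sum using (_⊎_; [_,_])
open import Data.Empty using (⊥-elim)
open import Function using (_∘_; id)
open import Function.Bundles using (Inverse; Injection)
open import Function.Properties.Inverse using (↔⇒↣; ↔-sym)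
open import Relation.Nullary using (¬_; yes; no)
open import Relation.Binary.PropositionalEquality as ≡ using (_≡_; _≢_)
open import Algebra.Bundles using (CommutativeRing)
import Algebra.Solver.Ring
open import Algebra.Solver.Ring.AlmostCommutativeRing
  using (fromCommutativeRing; _-Raw-AlmostCommutative⟶_)

m+m≡m*2 : ∀ m → m ℕ.+ m ≡ m ℕ.* 2
m+m≡m*2 = solve-∀

2m+2m≡m*4 : ∀ m → 2 ℕ.* m ℕ.+ 2 ℕ.* m ≡ m ℕ.* 4
2m+2m≡m*4 = solve-∀

m%2≡1⇒m^k%2≡1 : ∀ {m} k → m % 2 ≡ 1 → m ℕ.^ k % 2 ≡ 1
m%2≡1⇒m^k%2≡1     zero    _     = ≡.refl
m%2≡1⇒m^k%2≡1 {m} (suc k) m%2≡1 = begin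
  m ℕ.* m ℕ.^ k % 2                ≡⟨ DivMod.%-distribˡ-* m (m ℕ.^ k) 2 ⟩
  (m % 2) ℕ.* (m ℕ.^ k % 2) % 2    ≡⟨ ≡.cong₂ (λ a b → a ℕ.* b % 2) m%2≡1 (m%2≡1⇒m^k%2≡1 k m%2≡1) ⟩
  1                                ∎
  where open ≡.≡-Reasoning

[1+n]%2≡1⇒n≡h+h : ∀ {n} → suc n % 2 ≡ 1 → n ≡ suc n / 2 ℕ.+ suc n / 2
[1+n]%2≡1⇒n≡h+h {n} [1+n]%2≡1 = ≡.trans n≡h*2 (≡.sym (m+m≡m*2 (suc n / 2)))
  where
    n≡h*2 : n ≡ suc n / 2 ℕ.* 2
    n≡h*2 = ℕ.suc-injective (≡.trans (DivMod.m≡m%n+[m/n]*n (suc n) 2)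
                                      (≡.cong (ℕ._+ suc n / 2 ℕ.* 2) [1+n]%2≡1))

pointwise₃ : ∀ {a} {A : Set a} {f g : Fin 3 → A} →
  f zero ≡ g zero → f (suc zero) ≡ g (suc zero) → f (suc (suc zero)) ≡ g (suc (suc zero)) →
  ∀ i → f i ≡ g i
pointwise₃ e₀ e₁ e₂ zero             = e₀
pointwise₃ e₀ e₁ e₂ (suc zero)       = e₁
pointwise₃ e₀ e₁ e₂ (suc (suc zero)) = e₂

module ℤ-CoefficientRingSolver {c ℓ} (R : CommutativeRing c ℓ) where
  open CommutativeRing R hiding (zero)
  open import Algebra.Properties.Ring ring using (-0#≈0#; -‿involutive; -‿distribˡ-*; -‿distribʳ-*)
  open import Algebra.Properties.AbelianGroup +-abelianGroup using (⁻¹-∙-comm)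
  open import Algebra.Properties.CommutativeSemigroup +-commutativeSemigroup using (interchange)
  open import Algebra.Properties.Semiring.Mult.TCOptimised semiring
    using (1+×; ×-homo-+; ×1-homo-*) renaming (_×_ to _×′_)
  open import Relation.Binary.Reasoning.Setoid setoid

  -- The type-checking-optimised multiple _×′_ makes fromℤ (+ 2) reduce to 1# + 1#, so the
  -- solver constant con (+ 2) is definitionally 2#.
  fromℤ : ℤ → Carrier
  fromℤ (+ n)    = n ×′ 1#
  fromℤ -[1+ n ] = - (suc n ×′ 1#)

  fromℤ-neg : ∀ i → fromℤ (ℤ.- i) ≈ - fromℤ i
  fromℤ-neg (+ zero)  = sym -0#≈0#
  fromℤ-neg (+ suc n) = refl
  fromℤ-neg -[1+ n ]  = sym (-‿involutive _)

  fromℤ-⊖ : ∀ m n → fromℤ (m ⊖ n) ≈ m ×′ 1# - n ×′ 1#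
  fromℤ-⊖ zero    zero    = begin
    0#       ≈⟨ +-identityʳ 0# ⟨
    0# + 0#  ≈⟨ +-congˡ -0#≈0# ⟨
    0# - 0#  ∎
  fromℤ-⊖ zero    (suc n) = sym (+-identityˡ _)
  fromℤ-⊖ (suc m) zero    = begin
    suc m ×′ 1#       ≈⟨ +-identityʳ _ ⟨
    suc m ×′ 1# + 0#  ≈⟨ +-congˡ -0#≈0# ⟨
    suc m ×′ 1# - 0#  ∎
  fromℤ-⊖ (suc m) (suc n) = begin
    fromℤ (suc m ⊖ suc n)               ≡⟨ ≡.cong fromℤ (ℤ.[1+m]⊖[1+n]≡m⊖n m n) ⟩
    fromℤ (m ⊖ n)                       ≈⟨ fromℤ-⊖ m n ⟩
    m ×′ 1# - n ×′ 1#                   ≈⟨ +-identityˡ _ ⟨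
    0# + (m ×′ 1# - n ×′ 1#)            ≈⟨ +-congʳ (-‿inverseʳ 1#) ⟨
    (1# - 1#) + (m ×′ 1# - n ×′ 1#)     ≈⟨ interchange 1# (- 1#) (m ×′ 1#) (- (n ×′ 1#)) ⟩
    (1# + m ×′ 1#) + (- 1# - n ×′ 1#)   ≈⟨ +-congˡ (⁻¹-∙-comm 1# (n ×′ 1#)) ⟩
    (1# + m ×′ 1#) - (1# + n ×′ 1#)     ≈⟨ +-cong (1+× m 1#) (-‿cong (1+× n 1#)) ⟨
    suc m ×′ 1# - suc n ×′ 1#           ∎

  fromℤ-+ : ∀ i j → fromℤ (i ℤ.+ j) ≈ fromℤ i + fromℤ j
  fromℤ-+ (+ m)    (+ n)    = ×-homo-+ 1# m n
  fromℤ-+ (+ m)    -[1+ n ] = fromℤ-⊖ m (suc n)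
  fromℤ-+ -[1+ m ] (+ n)    = trans (fromℤ-⊖ n (suc m)) (+-comm _ _)
  fromℤ-+ -[1+ m ] -[1+ n ] = begin
    fromℤ (-[1+ m ] ℤ.+ -[1+ n ])        ≡⟨ ≡.cong fromℤ (ℤ.neg-distrib-+ (+ suc m) (+ suc n)) ⟨
    fromℤ (ℤ.- (+ suc m ℤ.+ + suc n))    ≈⟨ fromℤ-neg (+ suc m ℤ.+ + suc n) ⟩
    - fromℤ (+ suc m ℤ.+ + suc n)        ≈⟨ -‿cong (fromℤ-+ (+ suc m) (+ suc n)) ⟩
    - (suc m ×′ 1# + suc n ×′ 1#)        ≈⟨ ⁻¹-∙-comm _ _ ⟨
    fromℤ -[1+ m ] + fromℤ -[1+ n ]      ∎

  fromℤ-*⁺ : ∀ m j → fromℤ (+ m ℤ.* j) ≈ fromℤ (+ m) * fromℤ j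
  fromℤ-*⁺ m (+ n) = begin
    fromℤ (+ m ℤ.* + n)        ≡⟨ ≡.cong fromℤ (ℤ.pos-* m n) ⟨
    fromℤ (+ (m ℕ.* n))        ≈⟨ ×1-homo-* m n ⟩
    fromℤ (+ m) * fromℤ (+ n)  ∎
  fromℤ-*⁺ m -[1+ n ] = begin
    fromℤ (+ m ℤ.* -[1+ n ])           ≡⟨ ≡.cong fromℤ (ℤ.neg-distribʳ-* (+ m) (+ suc n)) ⟨
    fromℤ (ℤ.- (+ m ℤ.* + suc n))      ≈⟨ fromℤ-neg (+ m ℤ.* + suc n) ⟩
    - fromℤ (+ m ℤ.* + suc n)          ≈⟨ -‿cong (fromℤ-*⁺ m (+ suc n)) ⟩
    - (fromℤ (+ m) * fromℤ (+ suc n))  ≈⟨ -‿distribʳ-* _ _ ⟩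
    fromℤ (+ m) * fromℤ -[1+ n ]       ∎

  fromℤ-* : ∀ i j → fromℤ (i ℤ.* j) ≈ fromℤ i * fromℤ j
  fromℤ-* (+ m)    j = fromℤ-*⁺ m j
  fromℤ-* -[1+ m ] j = begin
    fromℤ (-[1+ m ] ℤ.* j)         ≡⟨ ≡.cong fromℤ (ℤ.neg-distribˡ-* (+ suc m) j) ⟨
    fromℤ (ℤ.- (+ suc m ℤ.* j))    ≈⟨ fromℤ-neg (+ suc m ℤ.* j) ⟩
    - fromℤ (+ suc m ℤ.* j)        ≈⟨ -‿cong (fromℤ-*⁺ (suc m) j) ⟩
    - (fromℤ (+ suc m) * fromℤ j)  ≈⟨ -‿distribˡ-* _ _ ⟩
    fromℤ -[1+ m ] * fromℤ j       ∎

  homomorphism : ℤ.+-*-rawRing -Raw-AlmostCommutative⟶ fromCommutativeRing R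
  homomorphism = record
    { ⟦_⟧    = fromℤ
    ; +-homo = fromℤ-+
    ; *-homo = fromℤ-*
    ; -‿homo = fromℤ-neg
    ; 0-homo = refl
    ; 1-homo = refl
    }

  fromℤ-≟ : ∀ i j → Maybe (fromℤ i ≈ fromℤ j)
  fromℤ-≟ i j with i ℤ.≟ j
  ... | yes i≡j = just (reflexive (≡.cong fromℤ i≡j))
  ... | no _    = nothing

  open Algebra.Solver.Ring ℤ.+-*-rawRing (fromCommutativeRing R) homomorphism fromℤ-≟ public
    using (solve; _:=_; _:+_; _:*_; :-_; _:-_; con)

module FieldProperties {q : ℕ} (F : FiniteField q) where
  open FiniteField F

  commutativeRing : CommutativeRing _ _
  commutativeRing = record { isCommutativeRing = isCommutativeRing }

  open CommutativeRing commutativeRing public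
    using ( _-_; -‿inverseʳ; +-identityˡ; +-identityʳ; *-identityˡ; *-identityʳ
          ; zeroˡ; zeroʳ; *-comm; *-assoc)
  open import Algebra.Properties.Ring (CommutativeRing.ring commutativeRing) public
    using (-‿involutive; -0#≈0#; -‿distribʳ-*; -1*x≈-x)
  open import Algebra.Properties.Group (CommutativeRing.+-group commutativeRing) public
    using (x∙y⁻¹≈ε⇒x≈y) renaming (∙-cancelʳ to +-cancelʳ)
  open ℤ-CoefficientRingSolver commutativeRing public
  open ≡.≡-Reasoning

  1≢0 : 1# ≢ 0#
  1≢0 = 0≢1 ∘ ≡.sym

  inverseˡ : ∀ {x} → x ≢ 0# → x ⁻¹ * x ≡ 1#
  inverseˡ {x} x≢0 = ≡.trans (*-comm (x ⁻¹) x) (inverseʳ x x≢0)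

  *-cancelʳ : ∀ {x y z} → z ≢ 0# → x * z ≡ y * z → x ≡ y
  *-cancelʳ {x} {y} {z} z≢0 xz≡yz = begin
    x                ≡⟨ divide x ⟨
    (x * z) * z ⁻¹   ≡⟨ ≡.cong (_* z ⁻¹) xz≡yz ⟩
    (y * z) * z ⁻¹   ≡⟨ divide y ⟩
    y                ∎
    where
      divide : ∀ w → (w * z) * z ⁻¹ ≡ w
      divide w = begin
        (w * z) * z ⁻¹  ≡⟨ *-assoc w z (z ⁻¹) ⟩
        w * (z * z ⁻¹)  ≡⟨ ≡.cong (w *_) (inverseʳ z z≢0) ⟩
        w * 1#          ≡⟨ *-identityʳ w ⟩
        w               ∎

  x*y≢0 : ∀ {x y} → x ≢ 0# → y ≢ 0# → x * y ≢ 0#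
  x*y≢0 {x} {y} x≢0 y≢0 xy≡0 = y≢0 (*-cancelʳ x≢0 (begin
    y * x   ≡⟨ *-comm y x ⟩
    x * y   ≡⟨ xy≡0 ⟩
    0#      ≡⟨ zeroˡ x ⟨
    0# * x  ∎))

  -x≢0 : ∀ {x} → x ≢ 0# → - x ≢ 0#
  -x≢0 {x} x≢0 -x≡0 = x≢0 (begin
    x        ≡⟨ -‿involutive x ⟨
    - (- x)  ≡⟨ ≡.cong -_ -x≡0 ⟩
    - 0#     ≡⟨ -0#≈0# ⟩
    0#       ∎)

  x⁻¹≢0 : ∀ {x} → x ≢ 0# → x ⁻¹ ≢ 0#
  x⁻¹≢0 {x} x≢0 x⁻¹≡0 = 1≢0 (begin
    1#        ≡⟨ inverseʳ x x≢0 ⟨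
    x * x ⁻¹  ≡⟨ ≡.cong (x *_) x⁻¹≡0 ⟩
    x * 0#    ≡⟨ zeroʳ x ⟩
    0#        ∎)

  inverse-unique : ∀ {x y z} → x * y ≡ 1# → x * z ≡ 1# → y ≡ z
  inverse-unique {x} {y} {z} xy≡1 xz≡1 = begin
    y             ≡⟨ *-identityʳ y ⟨
    y * 1#        ≡⟨ ≡.cong (y *_) xz≡1 ⟨
    y * (x * z)   ≡⟨ solve 3 (λ x y z → y :* (x :* z) := (x :* y) :* z) ≡.refl x y z ⟩
    (x * y) * z   ≡⟨ ≡.cong (_* z) xy≡1 ⟩
    1# * z        ≡⟨ *-identityˡ z ⟩
    z             ∎

  x*x≡1⇒x≡-1 : ∀ {x} → x * x ≡ 1# → x ≢ 1# → x ≡ - 1#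
  x*x≡1⇒x≡-1 {x} x²≡1 x≢1 = x∙y⁻¹≈ε⇒x≈y x (- 1#) (*-cancelʳ x-1≢0 (begin
    (x - - 1#) * (x - 1#)  ≡⟨ solve 1 (λ x → (x :- :- con (+ 1)) :* (x :- con (+ 1)) := x :* x :- con (+ 1))
                                      ≡.refl x ⟩
    x * x - 1#             ≡⟨ ≡.cong (_- 1#) x²≡1 ⟩
    1# - 1#                ≡⟨ -‿inverseʳ 1# ⟩
    0#                     ≡⟨ zeroˡ _ ⟨
    0# * (x - 1#)          ∎))
    where
      x-1≢0 : x - 1# ≢ 0#
      x-1≢0 = x≢1 ∘ x∙y⁻¹≈ε⇒x≈y x 1#

  -1≡[x*y⁻¹]² : ∀ {x y} → y ≢ 0# → x * x ≡ - (y * y) → - 1# ≡ (x * y ⁻¹) * (x * y ⁻¹)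
  -1≡[x*y⁻¹]² {x} {y} y≢0 x²≡-y² = begin
    - 1#                           ≡⟨ solve 0 (:- con (+ 1) := :- (con (+ 1) :* con (+ 1))) ≡.refl ⟩
    - (1# * 1#)                    ≡⟨ ≡.cong (λ t → - (t * t)) (inverseʳ y y≢0) ⟨
    - ((y * y ⁻¹) * (y * y ⁻¹))    ≡⟨ solve 2 (λ y z → :- ((y :* z) :* (y :* z)) := (:- (y :* y)) :* (z :* z))
                                            ≡.refl y (y ⁻¹) ⟩
    - (y * y) * (y ⁻¹ * y ⁻¹)      ≡⟨ ≡.cong (_* (y ⁻¹ * y ⁻¹)) x²≡-y² ⟨
    (x * x) * (y ⁻¹ * y ⁻¹)        ≡⟨ solve 2 (λ x z → (x :* x) :* (z :* z) := (x :* z) :* (x :* z))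
                                            ≡.refl x (y ⁻¹) ⟩
    (x * y ⁻¹) * (x * y ⁻¹)        ∎

module Powers {q : ℕ} (F : FiniteField q) (ω : FiniteField.Carrier F) where
  open Setup F ω
  open FieldProperties F
  open ≡.≡-Reasoning

  ^-homo-* : ∀ x m k → x ^ (m ℕ.+ k) ≡ x ^ m * x ^ k
  ^-homo-* x zero    k = ≡.sym (*-identityˡ (x ^ k))
  ^-homo-* x (suc m) k =
    ≡.trans (≡.cong (x *_) (^-homo-* x m k)) (≡.sym (*-assoc x (x ^ m) (x ^ k)))

  x^n≢0 : ∀ {x} n → x ≢ 0# → x ^ n ≢ 0#
  x^n≢0 zero    x≢0 = 1≢0
  x^n≢0 (suc n) x≢0 = x*y≢0 x≢0 (x^n≢0 n x≢0)

  x*y≡1⇒xⁿ*yⁿ≡1 : ∀ {x y} n → x * y ≡ 1# → x ^ n * y ^ n ≡ 1#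
  x*y≡1⇒xⁿ*yⁿ≡1 zero xy≡1 = *-identityˡ 1#
  x*y≡1⇒xⁿ*yⁿ≡1 {x} {y} (suc n) xy≡1 = begin
    (x * x ^ n) * (y * y ^ n)  ≡⟨ solve 4 (λ x xⁿ y yⁿ → (x :* xⁿ) :* (y :* yⁿ) := (x :* y) :* (xⁿ :* yⁿ))
                                          ≡.refl x (x ^ n) y (y ^ n) ⟩
    (x * y) * (x ^ n * y ^ n)  ≡⟨ ≡.cong₂ _*_ xy≡1 (x*y≡1⇒xⁿ*yⁿ≡1 n xy≡1) ⟩
    1# * 1#                    ≡⟨ *-identityˡ 1# ⟩
    1#                         ∎

  x^d≡1⇒x^[m*d]≡1 : ∀ {x d} m → x ^ d ≡ 1# → x ^ (m ℕ.* d) ≡ 1#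
  x^d≡1⇒x^[m*d]≡1 zero xᵈ≡1 = ≡.refl
  x^d≡1⇒x^[m*d]≡1 {x} {d} (suc m) xᵈ≡1 = begin
    x ^ (d ℕ.+ m ℕ.* d)    ≡⟨ ^-homo-* x d (m ℕ.* d) ⟩
    x ^ d * x ^ (m ℕ.* d)  ≡⟨ ≡.cong₂ _*_ xᵈ≡1 (x^d≡1⇒x^[m*d]≡1 m xᵈ≡1) ⟩
    1# * 1#                ≡⟨ *-identityˡ 1# ⟩
    1#                     ∎

  x^d≡1⇒x^[k%d]≡x^k : ∀ {x d} k .{{_ : ℕ.NonZero d}} → x ^ d ≡ 1# → x ^ (k % d) ≡ x ^ k
  x^d≡1⇒x^[k%d]≡x^k {x} {d} k xᵈ≡1 = begin
    x ^ (k % d)                        ≡⟨ *-identityʳ _ ⟨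
    x ^ (k % d) * 1#                   ≡⟨ ≡.cong (x ^ (k % d) *_) (x^d≡1⇒x^[m*d]≡1 (k / d) xᵈ≡1) ⟨
    x ^ (k % d) * x ^ ((k / d) ℕ.* d)  ≡⟨ ^-homo-* x (k % d) ((k / d) ℕ.* d) ⟨
    x ^ (k % d ℕ.+ (k / d) ℕ.* d)      ≡⟨ ≡.cong (x ^_) (DivMod.m≡m%n+[m/n]*n k d) ⟨
    x ^ k                              ∎

  infixr 8 _^ℤ_
  _^ℤ_ : Carrier → ℤ → Carrier
  x ^ℤ + n      = x ^ n
  x ^ℤ -[1+ n ] = (x ⁻¹) ^ suc n

  x^ℤz*x^ℤ[-z]≡1 : ∀ {x} z → x ≢ 0# → x ^ℤ z * x ^ℤ (ℤ.- z) ≡ 1#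
  x^ℤz*x^ℤ[-z]≡1 (+ zero)  x≢0 = *-identityˡ 1#
  x^ℤz*x^ℤ[-z]≡1 (+ suc n) x≢0 = x*y≡1⇒xⁿ*yⁿ≡1 (suc n) (inverseʳ _ x≢0)
  x^ℤz*x^ℤ[-z]≡1 -[1+ n ]  x≢0 = x*y≡1⇒xⁿ*yⁿ≡1 (suc n) (inverseˡ x≢0)

  x^ℤz≢0 : ∀ {x} z → x ≢ 0# → x ^ℤ z ≢ 0#
  x^ℤz≢0 {x} z x≢0 x^ℤz≡0 = 1≢0 (begin
    1#                      ≡⟨ x^ℤz*x^ℤ[-z]≡1 z x≢0 ⟨
    x ^ℤ z * x ^ℤ (ℤ.- z)   ≡⟨ ≡.cong (_* x ^ℤ (ℤ.- z)) x^ℤz≡0 ⟩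
    0# * x ^ℤ (ℤ.- z)       ≡⟨ zeroˡ _ ⟩
    0#                      ∎)

  ^ℤ-suc : ∀ {x} z → x ≢ 0# → x ^ℤ ℤ.suc z ≡ x * x ^ℤ z
  ^ℤ-suc (+ n)            x≢0 = ≡.refl
  ^ℤ-suc {x} -[1+ zero ]  x≢0 =
    ≡.sym (≡.trans (≡.cong (x *_) (*-identityʳ (x ⁻¹))) (inverseʳ x x≢0))
  ^ℤ-suc {x} -[1+ suc n ] x≢0 = begin
    (x ⁻¹) ^ suc n                ≡⟨ *-identityˡ _ ⟨
    1# * (x ⁻¹) ^ suc n           ≡⟨ ≡.cong (_* (x ⁻¹) ^ suc n) (inverseʳ x x≢0) ⟨
    (x * x ⁻¹) * (x ⁻¹) ^ suc n   ≡⟨ *-assoc x (x ⁻¹) _ ⟩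
    x * (x ⁻¹ * (x ⁻¹) ^ suc n)   ∎

  ^ℤ-ℕ+ : ∀ {x} m z → x ≢ 0# → x ^ℤ (+ m ℤ.+ z) ≡ x ^ m * x ^ℤ z
  ^ℤ-ℕ+ {x} zero    z x≢0 = ≡.trans (≡.cong (x ^ℤ_) (ℤ.+-identityˡ z)) (≡.sym (*-identityˡ _))
  ^ℤ-ℕ+ {x} (suc m) z x≢0 = begin
    x ^ℤ (+ suc m ℤ.+ z)      ≡⟨ ≡.cong (x ^ℤ_) (ℤ.suc-+ m z) ⟩
    x ^ℤ ℤ.suc (+ m ℤ.+ z)    ≡⟨ ^ℤ-suc (+ m ℤ.+ z) x≢0 ⟩
    x * x ^ℤ (+ m ℤ.+ z)      ≡⟨ ≡.cong (x *_) (^ℤ-ℕ+ m z x≢0) ⟩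
    x * (x ^ m * x ^ℤ z)      ≡⟨ *-assoc x (x ^ m) (x ^ℤ z) ⟨
    x ^ suc m * x ^ℤ z        ∎

  x^ℤ[2u]≡[x^ℤu]² : ∀ x u → x ^ℤ (+ 2 ℤ.* u) ≡ x ^ℤ u * x ^ℤ u
  x^ℤ[2u]≡[x^ℤu]² x (+ n) = begin
    x ^ℤ (+ 2 ℤ.* + n)     ≡⟨ ≡.cong (x ^ℤ_) (ℤ.pos-* 2 n) ⟨
    x ^ (n ℕ.+ (n ℕ.+ 0))  ≡⟨ ≡.cong (λ k → x ^ (n ℕ.+ k)) (ℕ.+-identityʳ n) ⟩
    x ^ (n ℕ.+ n)          ≡⟨ ^-homo-* x n n ⟩
    x ^ n * x ^ n          ∎
  x^ℤ[2u]≡[x^ℤu]² x -[1+ n ] = begin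
    (x ⁻¹) ^ (suc n ℕ.+ (suc n ℕ.+ 0))  ≡⟨ ≡.cong (λ k → (x ⁻¹) ^ (suc n ℕ.+ k)) (ℕ.+-identityʳ (suc n)) ⟩
    (x ⁻¹) ^ (suc n ℕ.+ suc n)          ≡⟨ ^-homo-* (x ⁻¹) (suc n) (suc n) ⟩
    (x ⁻¹) ^ suc n * (x ⁻¹) ^ suc n     ∎

module MonomialMatrices {q : ℕ} (F : FiniteField q) (ω : FiniteField.Carrier F) where
  open Setup F ω
  open FieldProperties F
  open Powers F ω
  open ≡.≡-Reasoning

  -- RowRescaling M I₃ d σ says that M is the monomial matrix with entry d i at (i , σ i).
  record RowRescaling (x y : Mat) (c : Fin 3 → Carrier) (ρ : Fin 3 → Fin 3) : Set where
    field
      entries : ∀ i j → x i j ≡ c i * y (ρ i) j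
  open RowRescaling public

  RowRescaling-trans : ∀ {x y z c d ρ σ} → RowRescaling x y c ρ → RowRescaling y z d σ →
    RowRescaling x z (λ i → c i * d (ρ i)) (σ ∘ ρ)
  RowRescaling-trans {c = c} {d} {ρ} x≡cy y≡dz .entries i j = begin
    _                         ≡⟨ x≡cy .entries i j ⟩
    c i * _                   ≡⟨ ≡.cong (c i *_) (y≡dz .entries (ρ i) j) ⟩
    c i * (d (ρ i) * _)       ≡⟨ *-assoc (c i) (d (ρ i)) _ ⟨
    (c i * d (ρ i)) * _       ∎

  RowRescaling-cong : ∀ {x y c c' ρ ρ'} → (∀ i → c i ≡ c' i) → (∀ i → ρ i ≡ ρ' i) →
    RowRescaling x y c ρ → RowRescaling x y c' ρ'
  RowRescaling-cong {y = y} c≡c' ρ≡ρ' x≡cy .entries i j =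
    ≡.trans (x≡cy .entries i j) (≡.cong₂ (λ a k → a * y k j) (c≡c' i) (ρ≡ρ' i))

  RowRescaling-·ʳ : ∀ {x y c ρ} → RowRescaling x y c ρ → ∀ N → RowRescaling (x · N) (y · N) c ρ
  RowRescaling-·ʳ {x} {y} {c} {ρ} x≡cy N .entries i j = begin
    (x · N) i j
      ≡⟨ ≡.cong₂ _+_ (≡.cong₂ _+_ (row zero) (row (suc zero))) (row (suc (suc zero))) ⟩
    (c i * y (ρ i) zero) * N zero j + (c i * y (ρ i) (suc zero)) * N (suc zero) j
      + (c i * y (ρ i) (suc (suc zero))) * N (suc (suc zero)) j
      ≡⟨ solve 7 (λ c y₀ y₁ y₂ n₀ n₁ n₂ → (c :* y₀) :* n₀ :+ (c :* y₁) :* n₁ :+ (c :* y₂) :* n₂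
                                        := c :* (y₀ :* n₀ :+ y₁ :* n₁ :+ y₂ :* n₂))
               ≡.refl (c i) (y (ρ i) zero) (y (ρ i) (suc zero)) (y (ρ i) (suc (suc zero)))
               (N zero j) (N (suc zero) j) (N (suc (suc zero)) j) ⟩
    c i * (y · N) (ρ i) j ∎
    where
      row : ∀ k → x i k * N k j ≡ (c i * y (ρ i) k) * N k j
      row k = ≡.cong (_* N k j) (x≡cy .entries i k)

  I₃-·ˡ : ∀ N i j → (I₃ · N) i j ≡ N i j
  I₃-·ˡ N i j = row i
    where
      n₀ = N zero j
      n₁ = N (suc zero) j
      n₂ = N (suc (suc zero)) j

      row : ∀ i → (I₃ · N) i j ≡ N i j
      row zero             = solve 3 (λ n₀ n₁ n₂ → con (+ 1) :* n₀ :+ con (+ 0) :* n₁ :+ con (+ 0) :* n₂ := n₀)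
                                     ≡.refl n₀ n₁ n₂
      row (suc zero)       = solve 3 (λ n₀ n₁ n₂ → con (+ 0) :* n₀ :+ con (+ 1) :* n₁ :+ con (+ 0) :* n₂ := n₁)
                                     ≡.refl n₀ n₁ n₂
      row (suc (suc zero)) = solve 3 (λ n₀ n₁ n₂ → con (+ 0) :* n₀ :+ con (+ 0) :* n₁ :+ con (+ 1) :* n₂ := n₂)
                                     ≡.refl n₀ n₁ n₂

  monomial-·ˡ : ∀ {M d σ} → RowRescaling M I₃ d σ → ∀ N → RowRescaling (M · N) N d σ
  monomial-·ˡ {d = d} {σ} M≡dI N .entries i j =
    ≡.trans (RowRescaling-·ʳ M≡dI N .entries i j) (≡.cong (d i *_) (I₃-·ˡ N (σ i) j))

  diagonal : Carrier → Carrier → Carrier → Mat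
  diagonal x y z = mat3 x 0# 0# 0# y 0# 0# 0# z

  antidiagonal : Carrier → Carrier → Carrier → Mat
  antidiagonal x y z = mat3 0# 0# x 0# y 0# z 0# 0#

  diagonal-monomial : ∀ x y z → RowRescaling (diagonal x y z) I₃ (x ∷ y ∷ z ∷ []) id
  diagonal-monomial x y z .entries zero             zero             = ≡.sym (*-identityʳ x)
  diagonal-monomial x y z .entries zero             (suc zero)       = ≡.sym (zeroʳ x)
  diagonal-monomial x y z .entries zero             (suc (suc zero)) = ≡.sym (zeroʳ x)
  diagonal-monomial x y z .entries (suc zero)       zero             = ≡.sym (zeroʳ y)
  diagonal-monomial x y z .entries (suc zero)       (suc zero)       = ≡.sym (*-identityʳ y)
  diagonal-monomial x y z .entries (suc zero)       (suc (suc zero)) = ≡.sym (zeroʳ y)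
  diagonal-monomial x y z .entries (suc (suc zero)) zero             = ≡.sym (zeroʳ z)
  diagonal-monomial x y z .entries (suc (suc zero)) (suc zero)       = ≡.sym (zeroʳ z)
  diagonal-monomial x y z .entries (suc (suc zero)) (suc (suc zero)) = ≡.sym (*-identityʳ z)

  antidiagonal-monomial : ∀ x y z → RowRescaling (antidiagonal x y z) I₃ (x ∷ y ∷ z ∷ []) opposite
  antidiagonal-monomial x y z .entries zero             zero             = ≡.sym (zeroʳ x)
  antidiagonal-monomial x y z .entries zero             (suc zero)       = ≡.sym (zeroʳ x)
  antidiagonal-monomial x y z .entries zero             (suc (suc zero)) = ≡.sym (*-identityʳ x)
  antidiagonal-monomial x y z .entries (suc zero)       zero             = ≡.sym (zeroʳ y)
  antidiagonal-monomial x y z .entries (suc zero)       (suc zero)       = ≡.sym (*-identityʳ y)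
  antidiagonal-monomial x y z .entries (suc zero)       (suc (suc zero)) = ≡.sym (zeroʳ y)
  antidiagonal-monomial x y z .entries (suc (suc zero)) zero             = ≡.sym (*-identityʳ z)
  antidiagonal-monomial x y z .entries (suc (suc zero)) (suc zero)       = ≡.sym (zeroʳ z)
  antidiagonal-monomial x y z .entries (suc (suc zero)) (suc (suc zero)) = ≡.sym (zeroʳ z)

  matPow-diagonal : ∀ x y n → RowRescaling (matPow (diagonal x 1# y) n) I₃ (x ^ n ∷ 1# ∷ y ^ n ∷ []) id
  matPow-diagonal x y zero    = diagonal-monomial 1# 1# 1#
  matPow-diagonal x y (suc n) =
    RowRescaling-cong (pointwise₃ ≡.refl (*-identityˡ 1#) ≡.refl) (λ _ → ≡.refl)
      (RowRescaling-trans (monomial-·ˡ (diagonal-monomial x 1# y) _) (matPow-diagonal x y n))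

  αpow-diagonal : ∀ z → RowRescaling (αpow z) I₃ (ω ^ℤ z ∷ 1# ∷ ω ^ℤ (ℤ.- z) ∷ []) id
  αpow-diagonal (+ zero)  = matPow-diagonal ω (ω ⁻¹) zero
  αpow-diagonal (+ suc n) = matPow-diagonal ω (ω ⁻¹) (suc n)
  αpow-diagonal -[1+ n ]  = matPow-diagonal (ω ⁻¹) ω (suc n)

  ·-diagonalʳ : ∀ {M d} → RowRescaling M I₃ d id → ∀ N i j → (N · M) i j ≡ N i j * d j
  ·-diagonalʳ {M} {d} M≡dI N i j =
    ≡.trans (≡.cong₂ _+_ (≡.cong₂ _+_ (entry zero) (entry (suc zero))) (entry (suc (suc zero)))) (column j)
    where
      entry : ∀ k → N i k * M k j ≡ N i k * (d k * I₃ k j)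
      entry k = ≡.cong (N i k *_) (M≡dI .entries k j)

      n₀ = N i zero
      n₁ = N i (suc zero)
      n₂ = N i (suc (suc zero))
      d₀ = d zero
      d₁ = d (suc zero)
      d₂ = d (suc (suc zero))

      column : ∀ j → n₀ * (d₀ * I₃ zero j) + n₁ * (d₁ * I₃ (suc zero) j) + n₂ * (d₂ * I₃ (suc (suc zero)) j)
                     ≡ N i j * d j
      column zero             =
        solve 6 (λ n₀ n₁ n₂ d₀ d₁ d₂ →
                   n₀ :* (d₀ :* con (+ 1)) :+ n₁ :* (d₁ :* con (+ 0)) :+ n₂ :* (d₂ :* con (+ 0)) := n₀ :* d₀)
                ≡.refl n₀ n₁ n₂ d₀ d₁ d₂
      column (suc zero)       =
        solve 6 (λ n₀ n₁ n₂ d₀ d₁ d₂ →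
                   n₀ :* (d₀ :* con (+ 0)) :+ n₁ :* (d₁ :* con (+ 1)) :+ n₂ :* (d₂ :* con (+ 0)) := n₁ :* d₁)
                ≡.refl n₀ n₁ n₂ d₀ d₁ d₂
      column (suc (suc zero)) =
        solve 6 (λ n₀ n₁ n₂ d₀ d₁ d₂ →
                   n₀ :* (d₀ :* con (+ 0)) :+ n₁ :* (d₁ :* con (+ 0)) :+ n₂ :* (d₂ :* con (+ 1)) := n₂ :* d₂)
                ≡.refl n₀ n₁ n₂ d₀ d₁ d₂

module DihedralCosets {q : ℕ} (F : FiniteField q) (ω : FiniteField.Carrier F) where
  open Setup F ω
  open FieldProperties F
  open MonomialMatrices F ω
  open ≡.≡-Reasoning

  -- An explicit witness of x ∈ H₀ g: every element of H₀ is a scalar multiple of a rotation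
  -- diag(w², 1, v²) or of a reflection β · diag(w², 1, v²), where w v = 1.
  data DihedralMultiple (x g : Mat) : Set where
    rotation   : ∀ {s w v} → s ≢ 0# → w * v ≡ 1# →
                 RowRescaling x g (s * (w * w) ∷ s ∷ s * (v * v) ∷ []) id → DihedralMultiple x g
    reflection : ∀ {s w v} → s ≢ 0# → w * v ≡ 1# →
                 RowRescaling x g (s * (v * v) ∷ - s ∷ s * (w * w) ∷ []) opposite → DihedralMultiple x g

  DihedralMultiple-scale : ∀ {l x y g} → l ≢ 0# → RowRescaling x y (λ _ → l) id →
    DihedralMultiple y g → DihedralMultiple x g
  DihedralMultiple-scale {l} l≢0 x≡ly (rotation {s} {w} {v} s≢0 wv≡1 y≡g) =
    rotation (x*y≢0 l≢0 s≢0) wv≡1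
      (RowRescaling-cong (pointwise₃ (≡.sym (*-assoc l s (w * w))) ≡.refl (≡.sym (*-assoc l s (v * v))))
        (λ _ → ≡.refl) (RowRescaling-trans x≡ly y≡g))
  DihedralMultiple-scale {l} l≢0 x≡ly (reflection {s} {w} {v} s≢0 wv≡1 y≡g) =
    reflection (x*y≢0 l≢0 s≢0) wv≡1
      (RowRescaling-cong
        (pointwise₃ (≡.sym (*-assoc l s (v * v))) (≡.sym (-‿distribʳ-* l s)) (≡.sym (*-assoc l s (w * w))))
        (λ _ → ≡.refl) (RowRescaling-trans x≡ly y≡g))

  private
    o²[sw²]≡s[ow]² : ∀ o s w → o ^ 2 * (s * (w * w)) ≡ s * ((o * w) * (o * w))
    o²[sw²]≡s[ow]² =
      solve 3 (λ o s w → (o :* (o :* con (+ 1))) :* (s :* (w :* w)) := s :* ((o :* w) :* (o :* w))) ≡.refl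

    [ow]*[o'v]≡1 : ∀ {o o' w v} → o * o' ≡ 1# → w * v ≡ 1# → (o * w) * (o' * v) ≡ 1#
    [ow]*[o'v]≡1 {o} {o'} {w} {v} oo'≡1 wv≡1 = begin
      (o * w) * (o' * v)  ≡⟨ solve 4 (λ o o' w v → (o :* w) :* (o' :* v) := (o :* o') :* (w :* v))
                                      ≡.refl o o' w v ⟩
      (o * o') * (w * v)  ≡⟨ ≡.cong₂ _*_ oo'≡1 wv≡1 ⟩
      1# * 1#             ≡⟨ *-identityˡ 1# ⟩
      1#                  ∎

  DihedralMultiple-rotate : ∀ {o o' x y g} → o * o' ≡ 1# → RowRescaling x y (o ^ 2 ∷ 1# ∷ o' ^ 2 ∷ []) id →
    DihedralMultiple y g → DihedralMultiple x g
  DihedralMultiple-rotate {o} {o'} oo'≡1 x≡oy (rotation {s} {w} {v} s≢0 wv≡1 y≡g) =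
    rotation s≢0 ([ow]*[o'v]≡1 oo'≡1 wv≡1)
      (RowRescaling-cong (pointwise₃ (o²[sw²]≡s[ow]² o s w) (*-identityˡ s) (o²[sw²]≡s[ow]² o' s v))
        (λ _ → ≡.refl) (RowRescaling-trans x≡oy y≡g))
  DihedralMultiple-rotate {o} {o'} oo'≡1 x≡oy (reflection {s} {w} {v} s≢0 wv≡1 y≡g) =
    reflection s≢0 ([ow]*[o'v]≡1 (≡.trans (*-comm o' o) oo'≡1) wv≡1)
      (RowRescaling-cong (pointwise₃ (o²[sw²]≡s[ow]² o s v) (*-identityˡ (- s)) (o²[sw²]≡s[ow]² o' s w))
        (λ _ → ≡.refl) (RowRescaling-trans x≡oy y≡g))

  DihedralMultiple-reflect : ∀ {x y g} → RowRescaling x y (1# ∷ - 1# ∷ 1# ∷ []) opposite →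
    DihedralMultiple y g → DihedralMultiple x g
  DihedralMultiple-reflect x≡βy (rotation {s} s≢0 wv≡1 y≡g) =
    reflection s≢0 wv≡1
      (RowRescaling-cong (pointwise₃ (*-identityˡ _) (-1*x≈-x s) (*-identityˡ _))
        (λ _ → ≡.refl) (RowRescaling-trans x≡βy y≡g))
  DihedralMultiple-reflect x≡βy (reflection {s} s≢0 wv≡1 y≡g) =
    rotation s≢0 wv≡1
      (RowRescaling-cong
        (pointwise₃ (*-identityˡ _) (≡.trans (-1*x≈-x (- s)) (-‿involutive s)) (*-identityˡ _))
        Finₚ.opposite-involutive (RowRescaling-trans x≡βy y≡g))

  InH₀⇒DihedralMultiple : ω ≢ 0# → ∀ g {M} → InH₀ M → DihedralMultiple (M · g) g
  InH₀⇒DihedralMultiple ω≢0 g h-id =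
    rotation 1≢0 (*-identityˡ 1#)
      (RowRescaling-cong (pointwise₃ 1≡1*[1*1] ≡.refl 1≡1*[1*1]) (λ _ → ≡.refl)
        (monomial-·ˡ (diagonal-monomial 1# 1# 1#) g))
    where
      1≡1*[1*1] : 1# ≡ 1# * (1# * 1#)
      1≡1*[1*1] = ≡.sym (≡.trans (*-identityˡ _) (*-identityˡ 1#))
  InH₀⇒DihedralMultiple ω≢0 g (h-α² {M} M∈H₀) =
    DihedralMultiple-rotate (inverseʳ ω ω≢0) (RowRescaling-·ʳ (monomial-·ˡ (αpow-diagonal (+ 2)) M) g)
      (InH₀⇒DihedralMultiple ω≢0 g M∈H₀)
  InH₀⇒DihedralMultiple ω≢0 g (h-α⁻² {M} M∈H₀) =
    DihedralMultiple-rotate (inverseˡ ω≢0) (RowRescaling-·ʳ (monomial-·ˡ (αpow-diagonal (ℤ.- + 2)) M) g)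
      (InH₀⇒DihedralMultiple ω≢0 g M∈H₀)
  InH₀⇒DihedralMultiple ω≢0 g (h-β {M} M∈H₀) =
    DihedralMultiple-reflect (RowRescaling-·ʳ (monomial-·ˡ (antidiagonal-monomial 1# (- 1#) 1#) M) g)
      (InH₀⇒DihedralMultiple ω≢0 g M∈H₀)
  InH₀⇒DihedralMultiple ω≢0 g (h-≃ {M} {M'} M∈H₀ (l , l≢0 , M≡lM')) =
    DihedralMultiple-scale (x⁻¹≢0 l≢0) (RowRescaling-·ʳ M'≡l⁻¹M g) (InH₀⇒DihedralMultiple ω≢0 g M∈H₀)
    where
      M'≡l⁻¹M : RowRescaling M' M (λ _ → l ⁻¹) id
      M'≡l⁻¹M .entries i j = begin
        M' i j                ≡⟨ *-identityˡ _ ⟨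
        1# * M' i j           ≡⟨ ≡.cong (_* M' i j) (inverseˡ l≢0) ⟨
        (l ⁻¹ * l) * M' i j   ≡⟨ *-assoc _ _ _ ⟩
        l ⁻¹ * (l * M' i j)   ≡⟨ ≡.cong (l ⁻¹ *_) (M≡lM' i j) ⟨
        l ⁻¹ * M i j          ∎

  ∈H₀·⇒DihedralMultiple : ω ≢ 0# → ∀ {x g} → x ∈H₀· g → DihedralMultiple x g
  ∈H₀·⇒DihedralMultiple ω≢0 {g = g} (M , M∈H₀ , (l , l≢0 , x≡l[M·g])) =
    DihedralMultiple-scale l≢0 (record { entries = x≡l[M·g] }) (InH₀⇒DihedralMultiple ω≢0 g M∈H₀)

  ≡ᶜ⇒DihedralMultiple : ω ≢ 0# → ∀ g h → g ≡ᶜ h → DihedralMultiple g h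
  ≡ᶜ⇒DihedralMultiple ω≢0 g h g≡ᶜh = ∈H₀·⇒DihedralMultiple ω≢0 (proj₁ (g≡ᶜh g) g∈H₀·g)
    where
      g∈H₀·g : g ∈H₀· g
      g∈H₀·g = I₃ , h-id , (1# , 1≢0 , λ i j → ≡.sym (≡.trans (*-identityˡ _) (I₃-·ˡ g i j)))

module PrimitiveElement {n : ℕ} (F : FiniteField (suc n)) (ω : FiniteField.Carrier F)
                        (isPrimitive : Setup.IsPrimitive F ω) where
  open Setup F ω
  open FieldProperties F
  open Powers F ω
  open ≡.≡-Reasoning

  ω≢0 : ω ≢ 0#
  ω≢0 = proj₁ isPrimitive

  private
    index : Carrier → Fin (suc n)
    index = Inverse.to enumeration

    index-injective : ∀ {x y} → index x ≡ index y → x ≡ y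
    index-injective = Injection.injective (↔⇒↣ enumeration)

    element-injective : ∀ {k l} → Inverse.from enumeration k ≡ Inverse.from enumeration l → k ≡ l
    element-injective = Injection.injective (↔⇒↣ (↔-sym enumeration))

    index0≢index : ∀ {x} → x ≢ 0# → index 0# ≢ index x
    index0≢index x≢0 = x≢0 ∘ index-injective ∘ ≡.sym

    nonzero-index : ∀ {x} → x ≢ 0# → Fin n
    nonzero-index x≢0 = punchOut (index0≢index x≢0)

    nonzero-index-injective : ∀ {x y} (x≢0 : x ≢ 0#) (y≢0 : y ≢ 0#) →
      nonzero-index x≢0 ≡ nonzero-index y≢0 → x ≡ y
    nonzero-index-injective x≢0 y≢0 =
      index-injective ∘ Finₚ.punchOut-injective (index0≢index x≢0) (index0≢index y≢0)

  nonzero : Fin n → Carrier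
  nonzero j = Inverse.from enumeration (punchIn (index 0#) j)

  nonzero≢0 : ∀ j → nonzero j ≢ 0#
  nonzero≢0 j nonzero≡0 = Finₚ.punchInᵢ≢i (index 0#) j
    (≡.trans (≡.sym (Inverse.strictlyInverseˡ enumeration _)) (≡.cong index nonzero≡0))

  nonzero-injective : ∀ {j k} → nonzero j ≡ nonzero k → j ≡ k
  nonzero-injective {j} {k} = Finₚ.punchIn-injective (index 0#) j k ∘ element-injective

  -- If ω ^ r ≡ 1, every nonzero element is a power ω ^ k with k < r, so the n nonzero elements
  -- inject into Fin r via their discrete logarithms modulo r.
  ω^r≡1⇒n≤r : ∀ {r} → 0 < r → ω ^ r ≡ 1# → n ≤ r
  ω^r≡1⇒n≤r {suc r} _ ω^r≡1 = Finₚ.injective⇒≤ {f = residue} residue-injective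
    where
      log : Fin n → ℕ
      log j = proj₁ (proj₂ isPrimitive (nonzero j) (nonzero≢0 j))

      nonzero≡ω^log : ∀ j → nonzero j ≡ ω ^ log j
      nonzero≡ω^log j = proj₂ (proj₂ isPrimitive (nonzero j) (nonzero≢0 j))

      residue : Fin n → Fin (suc r)
      residue j = fromℕ< (DivMod.m%n<n (log j) (suc r))

      residue-injective : ∀ {j k} → residue j ≡ residue k → j ≡ k
      residue-injective {j} {k} residue≡ = nonzero-injective (begin
        nonzero j              ≡⟨ nonzero≡ω^log j ⟩
        ω ^ log j              ≡⟨ x^d≡1⇒x^[k%d]≡x^k (log j) ω^r≡1 ⟨
        ω ^ (log j % suc r)    ≡⟨ ≡.cong (ω ^_) log%≡ ⟩
        ω ^ (log k % suc r)    ≡⟨ x^d≡1⇒x^[k%d]≡x^k (log k) ω^r≡1 ⟩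
        ω ^ log k              ≡⟨ nonzero≡ω^log k ⟨
        nonzero k              ∎)
        where
          log%≡ : log j % suc r ≡ log k % suc r
          log%≡ = ≡.trans (≡.sym (Finₚ.toℕ-fromℕ< _)) (≡.trans (≡.cong toℕ residue≡) (Finₚ.toℕ-fromℕ< _))

  ω^r≢1 : ∀ {r} → 0 < r → r < n → ω ^ r ≢ 1#
  ω^r≢1 0<r r<n = ℕ.<⇒≱ r<n ∘ ω^r≡1⇒n≤r 0<r

  ω^n≡1 : ω ^ n ≡ 1#
  ω^n≡1 with Finₚ.pigeonhole (ℕ.n<1+n n) (λ k → nonzero-index (x^n≢0 (toℕ k) ω≢0))
  ... | i , j , i<j , same-index = ≡.subst (λ d → ω ^ d ≡ 1#) d≡n ω^d≡1
    where
      d : ℕ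
      d = toℕ j ∸ toℕ i

      ω^i≡ω^j : ω ^ toℕ i ≡ ω ^ toℕ j
      ω^i≡ω^j = nonzero-index-injective (x^n≢0 (toℕ i) ω≢0) (x^n≢0 (toℕ j) ω≢0) same-index

      ω^d≡1 : ω ^ d ≡ 1#
      ω^d≡1 = *-cancelʳ (x^n≢0 (toℕ i) ω≢0) (begin
        ω ^ d * ω ^ toℕ i        ≡⟨ *-comm _ _ ⟩
        ω ^ toℕ i * ω ^ d        ≡⟨ ^-homo-* ω (toℕ i) d ⟨
        ω ^ (toℕ i ℕ.+ d)        ≡⟨ ≡.cong (ω ^_) (ℕ.m+[n∸m]≡n (ℕ.<⇒≤ i<j)) ⟩
        ω ^ toℕ j                ≡⟨ ω^i≡ω^j ⟨
        ω ^ toℕ i                ≡⟨ *-identityˡ _ ⟨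
        1# * ω ^ toℕ i           ∎)

      d≡n : d ≡ n
      d≡n = ℕ.≤-antisym (ℕ.≤-trans (ℕ.m∸n≤m (toℕ j) (toℕ i)) (ℕ.≤-pred (Finₚ.toℕ<n j)))
                        (ω^r≡1⇒n≤r (ℕ.m<n⇒0<n∸m i<j) ω^d≡1)

  ω^k≡1⇒n∣k : ∀ {k} .{{_ : ℕ.NonZero n}} → ω ^ k ≡ 1# → n ∣ k
  ω^k≡1⇒n∣k {k} ω^k≡1 with k % n in k%n≡r
  ... | zero  = Div.m%n≡0⇒n∣m k n k%n≡r
  ... | suc r = ⊥-elim (ℕ.<⇒≱ (≡.subst (_< n) k%n≡r (DivMod.m%n<n k n))
                               (ω^r≡1⇒n≤r (s≤s z≤n) (begin
                                 ω ^ suc r    ≡⟨ ≡.cong (ω ^_) k%n≡r ⟨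
                                 ω ^ (k % n)  ≡⟨ x^d≡1⇒x^[k%d]≡x^k k ω^n≡1 ⟩
                                 ω ^ k        ≡⟨ ω^k≡1 ⟩
                                 1#           ∎)))

  ω^half≡-1 : ∀ {m} → 0 < m → m ℕ.+ m ≡ n → ω ^ m ≡ - 1#
  ω^half≡-1 {m} 0<m m+m≡n = x*x≡1⇒x≡-1 ω^m*ω^m≡1 (ω^r≢1 0<m m<n)
    where
      m<n : m < n
      m<n = ≡.subst (m <_) m+m≡n (ℕ.m<m+n m 0<m)

      ω^m*ω^m≡1 : ω ^ m * ω ^ m ≡ 1#
      ω^m*ω^m≡1 = ≡.trans (≡.sym (^-homo-* ω m m)) (≡.trans (≡.cong (ω ^_) m+m≡n) ω^n≡1)

module OddOrder {n : ℕ} (F : FiniteField (suc n)) (ω : FiniteField.Carrier F)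
                (isPrimitive : Setup.IsPrimitive F ω) {h : ℕ} (n≡h+h : n ≡ h ℕ.+ h) (0<h : 0 < h) where
  open Setup F ω
  open FieldProperties F
  open Powers F ω
  open PrimitiveElement F ω isPrimitive
  open ≡.≡-Reasoning

  private
    h<n : h < n
    h<n = ≡.subst (h <_) (≡.sym n≡h+h) (ℕ.m<m+n h 0<h)

    0<n : 0 < n
    0<n = ℕ.<-trans 0<h h<n

    instance
      n≢0 : ℕ.NonZero n
      n≢0 = ℕ.>-nonZero 0<n

  ω^h≡-1 : ω ^ h ≡ - 1#
  ω^h≡-1 = ω^half≡-1 0<h (≡.sym n≡h+h)

  -1≢1 : - 1# ≢ 1#
  -1≢1 = ω^r≢1 0<h h<n ∘ ≡.trans ω^h≡-1

  2≢0 : 2# ≢ 0#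
  2≢0 2≡0 =
    -1≢1 (≡.sym (x∙y⁻¹≈ε⇒x≈y 1# (- 1#) (≡.trans (≡.cong (λ t → 1# + t) (-‿involutive 1#)) 2≡0)))

  -1≡y²⇒q≡1mod4 : ∀ {y} → - 1# ≡ y * y → suc n % 4 ≡ 1
  -1≡y²⇒q≡1mod4 {y} -1≡y² = begin
    suc n % 4              ≡⟨ ≡.cong (λ m → suc m % 4) n≡g*4 ⟩
    (1 ℕ.+ g ℕ.* 4) % 4    ≡⟨ DivMod.[m+kn]%n≡m%n 1 g 4 ⟩
    1                      ∎
    where
      y≢0 : y ≢ 0#
      y≢0 y≡0 = -x≢0 1≢0 (≡.trans -1≡y² (≡.trans (≡.cong (λ t → t * t) y≡0) (zeroˡ 0#)))

      k : ℕ
      k = proj₁ (proj₂ isPrimitive y y≢0)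

      ω^[k+k+h]≡1 : ω ^ (k ℕ.+ k ℕ.+ h) ≡ 1#
      ω^[k+k+h]≡1 = begin
        ω ^ (k ℕ.+ k ℕ.+ h)        ≡⟨ ^-homo-* ω (k ℕ.+ k) h ⟩
        ω ^ (k ℕ.+ k) * ω ^ h      ≡⟨ ≡.cong₂ _*_ (^-homo-* ω k k) ω^h≡-1 ⟩
        (ω ^ k * ω ^ k) * - 1#     ≡⟨ ≡.cong (λ t → (t * t) * - 1#) (proj₂ (proj₂ isPrimitive y y≢0)) ⟨
        (y * y) * - 1#             ≡⟨ ≡.cong (_* - 1#) -1≡y² ⟨
        - 1# * - 1#                ≡⟨ solve 0 (:- con (+ 1) :* :- con (+ 1) := con (+ 1)) ≡.refl ⟩
        1#                         ∎

      2∣h : 2 ∣ h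
      2∣h = Div.∣m+n∣m⇒∣n (Div.∣-trans (Div.divides h (≡.trans n≡h+h (m+m≡m*2 h)))
                                        (ω^k≡1⇒n∣k ω^[k+k+h]≡1))
                          (Div.divides k (m+m≡m*2 k))

      g : ℕ
      g = Div._∣_.quotient 2∣h

      n≡g*4 : n ≡ g ℕ.* 4
      n≡g*4 = begin
        n                        ≡⟨ n≡h+h ⟩
        h ℕ.+ h                  ≡⟨ ≡.cong₂ ℕ._+_ (Div._∣_.equality 2∣h) (Div._∣_.equality 2∣h) ⟩
        g ℕ.* 2 ℕ.+ g ℕ.* 2      ≡⟨ ℕ.*-distribˡ-+ g 2 2 ⟨
        g ℕ.* 4                  ∎

  q≡1mod4⇒ω^[2K]≡-1 : suc n % 4 ≡ 1 → ω ^ (2 ℕ.* (n / 4)) ≡ - 1#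
  q≡1mod4⇒ω^[2K]≡-1 q%4≡1 = ω^half≡-1 0<2K 2K+2K≡n
    where
      K = n / 4

      n≡K*4 : n ≡ K ℕ.* 4
      n≡K*4 = ≡.sym (DivMod.m/n*n≡m (Div.divides (suc n / 4) (ℕ.suc-injective
                (≡.trans (DivMod.m≡m%n+[m/n]*n (suc n) 4) (≡.cong (ℕ._+ (suc n / 4) ℕ.* 4) q%4≡1)))))

      2K+2K≡n : 2 ℕ.* K ℕ.+ 2 ℕ.* K ≡ n
      2K+2K≡n = ≡.trans (2m+2m≡m*4 K) (≡.sym n≡K*4)

      0<2K : 0 < 2 ℕ.* K
      0<2K = ℕ.n≢0⇒n>0 λ 2K≡0 →
        ℕ.<⇒≢ 0<n (≡.sym (≡.trans (≡.sym 2K+2K≡n) (≡.cong₂ ℕ._+_ 2K≡0 2K≡0)))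

  admissible⇒ξ²+1≢0 : ∀ {ξ} → Admissible ξ → ξ * ξ + 1# ≢ 0#
  admissible⇒ξ²+1≢0 {ξ} (_ , q≡1mod4⇒ξ²≢-1) ξ²+1≡0 =
    q≡1mod4⇒ξ²≢-1 (-1≡y²⇒q≡1mod4 (≡.sym ξ²≡-1)) ξ²≡-1
    where
      ξ²≡-1 : ξ * ξ ≡ - 1#
      ξ²≡-1 = x∙y⁻¹≈ε⇒x≈y (ξ * ξ) (- 1#) (≡.trans (≡.cong (λ t → ξ * ξ + t) (-‿involutive 1#)) ξ²+1≡0)

module CosetsOfH₀ {n : ℕ} (F : FiniteField (suc n)) (ω : FiniteField.Carrier F)
                  (isPrimitive : Setup.IsPrimitive F ω) {h : ℕ} (n≡h+h : n ≡ h ℕ.+ h) (0<h : 0 < h) where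
  open Setup F ω
  open FieldProperties F
  open Powers F ω
  open MonomialMatrices F ω
  open DihedralCosets F ω
  open PrimitiveElement F ω isPrimitive
  open OddOrder F ω isPrimitive n≡h+h 0<h
  open ≡.≡-Reasoning

  αpow-≃ : ∀ z z' → ω ^ℤ z ≡ ω ^ℤ z' → αpow z ≃ αpow z'
  αpow-≃ z z' ω^z≡ω^z' = 1# , 1≢0 , λ i j → begin
    αpow z i j                                       ≡⟨ same-diagonal .entries i j ⟩
    (ω ^ℤ z' ∷ 1# ∷ ω ^ℤ (ℤ.- z') ∷ []) i * I₃ i j   ≡⟨ αpow-diagonal z' .entries i j ⟨
    αpow z' i j                                      ≡⟨ *-identityˡ _ ⟨
    1# * αpow z' i j                                 ∎
    where
      ω^[-z]≡ω^[-z'] : ω ^ℤ (ℤ.- z) ≡ ω ^ℤ (ℤ.- z')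
      ω^[-z]≡ω^[-z'] = inverse-unique (x^ℤz*x^ℤ[-z]≡1 z ω≢0)
        (≡.trans (≡.cong (_* ω ^ℤ (ℤ.- z')) ω^z≡ω^z') (x^ℤz*x^ℤ[-z]≡1 z' ω≢0))

      same-diagonal : RowRescaling (αpow z) I₃ (ω ^ℤ z' ∷ 1# ∷ ω ^ℤ (ℤ.- z') ∷ []) id
      same-diagonal = RowRescaling-cong (pointwise₃ ω^z≡ω^z' ≡.refl ω^[-z]≡ω^[-z']) (λ _ → ≡.refl)
                        (αpow-diagonal z)

  ·γ-column₀ : ∀ T c i → (T · γ c) i zero ≡ T i zero
  ·γ-column₀ T c i =
    solve 3 (λ t₀ t₁ t₂ → t₀ :* con (+ 1) :+ t₁ :* con (+ 0) :+ t₂ :* con (+ 0) := t₀) ≡.refl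
      (T i zero) (T i (suc zero)) (T i (suc (suc zero)))

  ·γ-column₁ : ∀ T c i → (T · γ c) i (suc zero) ≡ T i zero * c + T i (suc zero)
  ·γ-column₁ T c i =
    solve 4 (λ c t₀ t₁ t₂ → t₀ :* c :+ t₁ :* con (+ 1) :+ t₂ :* con (+ 0) := t₀ :* c :+ t₁) ≡.refl
      c (T i zero) (T i (suc zero)) (T i (suc (suc zero)))

  τγα-column₀ : ∀ ξ c z i → (τ ξ · γ c · αpow z) i zero ≡ τ ξ i zero * ω ^ℤ z
  τγα-column₀ ξ c z i = ≡.trans (·-diagonalʳ (αpow-diagonal z) (τ ξ · γ c) i zero)
                                (≡.cong (_* ω ^ℤ z) (·γ-column₀ (τ ξ) c i))

  τγα-column₁ : ∀ ξ c z i → (τ ξ · γ c · αpow z) i (suc zero) ≡ τ ξ i zero * c + τ ξ i (suc zero)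
  τγα-column₁ ξ c z i = ≡.trans (·-diagonalʳ (αpow-diagonal z) (τ ξ · γ c) i (suc zero))
                                (≡.trans (*-identityʳ _) (·γ-column₁ (τ ξ) c i))

  module Columns (ξ₁ c₁ : Carrier) (z₁ : ℤ) (ξ₂ c₂ : Carrier) (z₂ : ℤ) {d ρ}
                 (e : RowRescaling (τ ξ₁ · γ c₁ · αpow z₁) (τ ξ₂ · γ c₂ · αpow z₂) d ρ) where

    column₀ : ∀ i → τ ξ₁ i zero * ω ^ℤ z₁ ≡ d i * (τ ξ₂ (ρ i) zero * ω ^ℤ z₂)
    column₀ i = ≡.trans (≡.sym (τγα-column₀ ξ₁ c₁ z₁ i))
                        (≡.trans (e .entries i zero) (≡.cong (d i *_) (τγα-column₀ ξ₂ c₂ z₂ (ρ i))))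

    column₁ : ∀ i → τ ξ₁ i zero * c₁ + τ ξ₁ i (suc zero) ≡ d i * (τ ξ₂ (ρ i) zero * c₂ + τ ξ₂ (ρ i) (suc zero))
    column₁ i = ≡.trans (≡.sym (τγα-column₁ ξ₁ c₁ z₁ i))
                        (≡.trans (e .entries i (suc zero)) (≡.cong (d i *_) (τγα-column₁ ξ₂ c₂ z₂ (ρ i))))

  τγα₁₀≢0 : ∀ {ξ} c z → ξ ≢ 0# → (τ ξ · γ c · αpow z) (suc zero) zero ≢ 0#
  τγα₁₀≢0 {ξ} c z ξ≢0 = x*y≢0 (x*y≢0 2≢0 ξ≢0) (x^ℤz≢0 z ω≢0) ∘ ≡.trans (≡.sym (τγα-column₀ ξ c z (suc zero)))

  γ-coset-injective : ∀ c₁ c₂ → γ c₁ ≡ᶜ γ c₂ → c₁ ≡ c₂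
  γ-coset-injective c₁ c₂ γ₁≡ᶜγ₂ with ≡ᶜ⇒DihedralMultiple ω≢0 (γ c₁) (γ c₂) γ₁≡ᶜγ₂
  ... | rotation {s} {w} _ _ e = begin
    c₁                  ≡⟨ e .entries zero (suc zero) ⟩
    s * (w * w) * c₂    ≡⟨ ≡.cong (_* c₂) (≡.trans (e .entries zero zero) (*-identityʳ _)) ⟨
    1# * c₂             ≡⟨ *-identityˡ c₂ ⟩
    c₂                  ∎
  ... | reflection _ _ e = ⊥-elim (1≢0 (≡.trans (e .entries zero zero) (zeroʳ _)))

  γ≢ᶜτγα : ∀ ξ → Admissible ξ → ∀ c₁ c₂ u → ¬ (γ c₁ ≡ᶜ τ ξ · γ c₂ · αpow (+ 2 ℤ.* u))
  γ≢ᶜτγα ξ (ξ≢0 , _) c₁ c₂ u γ≡ᶜτγα with ≡ᶜ⇒DihedralMultiple ω≢0 (γ c₁) (τ ξ · γ c₂ · αpow (+ 2 ℤ.* u)) γ≡ᶜτγα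
  ... | rotation   s≢0 _ e = x*y≢0 s≢0        (τγα₁₀≢0 c₂ (+ 2 ℤ.* u) ξ≢0) (≡.sym (e .entries (suc zero) zero))
  ... | reflection s≢0 _ e = x*y≢0 (-x≢0 s≢0) (τγα₁₀≢0 c₂ (+ 2 ℤ.* u) ξ≢0) (≡.sym (e .entries (suc zero) zero))

  private
    ξ[ξ²+1]≢0 : ∀ {ξ} → Admissible ξ → ξ * (ξ * ξ + 1#) ≢ 0#
    ξ[ξ²+1]≢0 adm = x*y≢0 (proj₁ adm) (admissible⇒ξ²+1≢0 adm)

  same-τ-rotation : ∀ ξ c₁ c₂ z₁ z₂ {X s Z} → Admissible ξ →
    RowRescaling (τ ξ · γ c₁ · αpow z₁) (τ ξ · γ c₂ · αpow z₂) (X ∷ s ∷ Z ∷ []) id →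
    c₁ ≡ c₂ × ω ^ℤ z₁ ≡ ω ^ℤ z₂
  same-τ-rotation ξ c₁ c₂ z₁ z₂ {X} {s} {Z} adm e = +-cancelʳ ξ c₁ c₂ c₁+ξ≡c₂+ξ , a₁≡a₂
    where
      open Columns ξ c₁ z₁ ξ c₂ z₂ e
      a₁ = ω ^ℤ z₁
      a₂ = ω ^ℤ z₂

      X≡Z : X ≡ Z
      X≡Z = *-cancelʳ (x*y≢0 (x*y≢0 (proj₁ adm) (proj₁ adm)) (x^ℤz≢0 z₂ ω≢0)) (begin
        X * (ξ * ξ * a₂)
          ≡⟨ solve 3 (λ X ξ a → X :* (ξ :* ξ :* a) := ξ :* ξ :* (X :* (con (+ 1) :* a))) ≡.refl X ξ a₂ ⟩
        ξ * ξ * (X * (1# * a₂))    ≡⟨ ≡.cong (ξ * ξ *_) (column₀ zero) ⟨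
        ξ * ξ * (1# * a₁)          ≡⟨ ≡.cong (ξ * ξ *_) (*-identityˡ a₁) ⟩
        ξ * ξ * a₁                 ≡⟨ column₀ (suc (suc zero)) ⟩
        Z * (ξ * ξ * a₂)           ∎)

      X≡1 : X ≡ 1#
      X≡1 = *-cancelʳ (ξ[ξ²+1]≢0 adm) (begin
        X * (ξ * (ξ * ξ + 1#))
          ≡⟨ solve 3 (λ X ξ c → X :* (ξ :* (ξ :* ξ :+ con (+ 1)))
                                := ξ :* ξ :* (X :* (con (+ 1) :* c :+ ξ)) :- X :* (ξ :* ξ :* c :+ :- ξ))
                   ≡.refl X ξ c₂ ⟩
        ξ * ξ * (X * (1# * c₂ + ξ)) - X * (ξ * ξ * c₂ + - ξ)
          ≡⟨ ≡.cong₂ (λ p r → ξ * ξ * p - r) (column₁ zero)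
                     (≡.trans (column₁ (suc (suc zero))) (≡.cong (_* _) (≡.sym X≡Z))) ⟨
        ξ * ξ * (1# * c₁ + ξ) - (ξ * ξ * c₁ + - ξ)
          ≡⟨ solve 2 (λ ξ c → ξ :* ξ :* (con (+ 1) :* c :+ ξ) :- (ξ :* ξ :* c :+ :- ξ)
                              := con (+ 1) :* (ξ :* (ξ :* ξ :+ con (+ 1)))) ≡.refl ξ c₁ ⟩
        1# * (ξ * (ξ * ξ + 1#))   ∎)

      c₁+ξ≡c₂+ξ : c₁ + ξ ≡ c₂ + ξ
      c₁+ξ≡c₂+ξ = begin
        c₁ + ξ               ≡⟨ ≡.cong (_+ ξ) (*-identityˡ c₁) ⟨
        1# * c₁ + ξ          ≡⟨ column₁ zero ⟩
        X * (1# * c₂ + ξ)    ≡⟨ ≡.cong (_* (1# * c₂ + ξ)) X≡1 ⟩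
        1# * (1# * c₂ + ξ)   ≡⟨ *-identityˡ _ ⟩
        1# * c₂ + ξ          ≡⟨ ≡.cong (_+ ξ) (*-identityˡ c₂) ⟩
        c₂ + ξ               ∎

      a₁≡a₂ : a₁ ≡ a₂
      a₁≡a₂ = begin
        a₁                ≡⟨ *-identityˡ a₁ ⟨
        1# * a₁           ≡⟨ column₀ zero ⟩
        X * (1# * a₂)     ≡⟨ ≡.cong (_* (1# * a₂)) X≡1 ⟩
        1# * (1# * a₂)    ≡⟨ ≡.trans (*-identityˡ _) (*-identityˡ a₂) ⟩
        a₂                ∎

  same-τ-reflection : ∀ ξ c₁ c₂ z₁ z₂ {X Y Z} → Admissible ξ →
    RowRescaling (τ ξ · γ c₁ · αpow z₁) (τ ξ · γ c₂ · αpow z₂) (X ∷ Y ∷ Z ∷ []) opposite →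
    ω ^ℤ z₁ ≡ - (ω ^ℤ z₂) × c₂ ≡ ξ ⁻¹ + - ξ + - c₁
  same-τ-reflection ξ c₁ c₂ z₁ z₂ {X} {Y} {Z} adm e = a₁≡-a₂ , c₂≡ξ⁻¹-ξ-c₁
    where
      open Columns ξ c₁ z₁ ξ c₂ z₂ e
      ξ≢0 = proj₁ adm
      a₁ = ω ^ℤ z₁
      a₂ = ω ^ℤ z₂
      a₂≢0 = x^ℤz≢0 z₂ ω≢0

      a₁≡Ya₂ : a₁ ≡ Y * a₂
      a₁≡Ya₂ = *-cancelʳ (x*y≢0 2≢0 ξ≢0) (begin
        a₁ * (2# * ξ)          ≡⟨ *-comm a₁ _ ⟩
        2# * ξ * a₁            ≡⟨ column₀ (suc zero) ⟩
        Y * (2# * ξ * a₂)      ≡⟨ solve 3 (λ Y t a → Y :* (t :* a) := Y :* a :* t) ≡.refl Y (2# * ξ) a₂ ⟩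
        Y * a₂ * (2# * ξ)      ∎)

      Xξ²≡Y : X * (ξ * ξ) ≡ Y
      Xξ²≡Y = *-cancelʳ a₂≢0 (begin
        X * (ξ * ξ) * a₂       ≡⟨ *-assoc X (ξ * ξ) a₂ ⟩
        X * (ξ * ξ * a₂)       ≡⟨ column₀ zero ⟨
        1# * a₁                ≡⟨ *-identityˡ a₁ ⟩
        a₁                     ≡⟨ a₁≡Ya₂ ⟩
        Y * a₂                 ∎)

      Z≡ξ²Y : Z ≡ ξ * ξ * Y
      Z≡ξ²Y = *-cancelʳ a₂≢0 (begin
        Z * a₂                 ≡⟨ ≡.cong (Z *_) (*-identityˡ a₂) ⟨
        Z * (1# * a₂)          ≡⟨ column₀ (suc (suc zero)) ⟨
        ξ * ξ * a₁             ≡⟨ ≡.cong (ξ * ξ *_) a₁≡Ya₂ ⟩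
        ξ * ξ * (Y * a₂)       ≡⟨ *-assoc (ξ * ξ) Y a₂ ⟨
        ξ * ξ * Y * a₂         ∎)

      ξ[c₁+ξ]≡Y[ξc₂-1] : ξ * (1# * c₁ + ξ) ≡ Y * (ξ * c₂ - 1#)
      ξ[c₁+ξ]≡Y[ξc₂-1] = begin
        ξ * (1# * c₁ + ξ)
          ≡⟨ ≡.cong (ξ *_) (column₁ zero) ⟩
        ξ * (X * (ξ * ξ * c₂ + - ξ))
          ≡⟨ solve 3 (λ ξ X c → ξ :* (X :* (ξ :* ξ :* c :+ :- ξ)) := X :* (ξ :* ξ) :* (ξ :* c :- con (+ 1)))
                     ≡.refl ξ X c₂ ⟩
        X * (ξ * ξ) * (ξ * c₂ - 1#)
          ≡⟨ ≡.cong (_* (ξ * c₂ - 1#)) Xξ²≡Y ⟩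
        Y * (ξ * c₂ - 1#)               ∎

      Y≡-1 : Y ≡ - 1#
      Y≡-1 = ≡.trans (≡.sym (-‿involutive Y)) (≡.cong -_ (*-cancelʳ (ξ[ξ²+1]≢0 adm) (begin
        - Y * (ξ * (ξ * ξ + 1#))
          ≡⟨ solve 3 (λ Y ξ c → :- Y :* (ξ :* (ξ :* ξ :+ con (+ 1)))
                                := ξ :* (Y :* (ξ :* c :- con (+ 1))) :- ξ :* ξ :* Y :* (con (+ 1) :* c :+ ξ))
                   ≡.refl Y ξ c₂ ⟩
        ξ * (Y * (ξ * c₂ - 1#)) - ξ * ξ * Y * (1# * c₂ + ξ)
          ≡⟨ ≡.cong₂ (λ p r → ξ * p - r) ξ[c₁+ξ]≡Y[ξc₂-1]
                     (≡.trans (column₁ (suc (suc zero))) (≡.cong (_* (1# * c₂ + ξ)) Z≡ξ²Y)) ⟨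
        ξ * (ξ * (1# * c₁ + ξ)) - (ξ * ξ * c₁ + - ξ)
          ≡⟨ solve 2 (λ ξ c → ξ :* (ξ :* (con (+ 1) :* c :+ ξ)) :- (ξ :* ξ :* c :+ :- ξ)
                              := con (+ 1) :* (ξ :* (ξ :* ξ :+ con (+ 1)))) ≡.refl ξ c₁ ⟩
        1# * (ξ * (ξ * ξ + 1#))         ∎)))

      a₁≡-a₂ : a₁ ≡ - a₂
      a₁≡-a₂ = ≡.trans a₁≡Ya₂ (≡.trans (≡.cong (_* a₂) Y≡-1) (-1*x≈-x a₂))

      c₂≡ξ⁻¹-ξ-c₁ : c₂ ≡ ξ ⁻¹ + - ξ + - c₁
      c₂≡ξ⁻¹-ξ-c₁ = *-cancelʳ ξ≢0 (begin
        c₂ * ξ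
          ≡⟨ solve 2 (λ ξ c → c :* ξ := con (+ 1) :- (:- con (+ 1)) :* (ξ :* c :- con (+ 1))) ≡.refl ξ c₂ ⟩
        1# - (- 1#) * (ξ * c₂ - 1#)
          ≡⟨ ≡.cong (λ t → 1# - t * (ξ * c₂ - 1#)) Y≡-1 ⟨
        1# - Y * (ξ * c₂ - 1#)
          ≡⟨ ≡.cong (λ t → 1# - t) ξ[c₁+ξ]≡Y[ξc₂-1] ⟨
        1# - ξ * (1# * c₁ + ξ)
          ≡⟨ ≡.cong (_- ξ * (1# * c₁ + ξ)) (inverseʳ ξ ξ≢0) ⟨
        ξ * ξ ⁻¹ - ξ * (1# * c₁ + ξ)
          ≡⟨ solve 3 (λ ξ ξ⁻¹ c → ξ :* ξ⁻¹ :- ξ :* (con (+ 1) :* c :+ ξ) := (ξ⁻¹ :+ :- ξ :+ :- c) :* ξ)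
                     ≡.refl ξ (ξ ⁻¹) c₁ ⟩
        (ξ ⁻¹ + - ξ + - c₁) * ξ
          ∎)

  τγα-coset-collision : ∀ ξ → Admissible ξ → ∀ c₁ c₂ (u₁ u₂ : ℤ) →
    τ ξ · γ c₁ · αpow (+ 2 ℤ.* u₁) ≡ᶜ τ ξ · γ c₂ · αpow (+ 2 ℤ.* u₂) →
    ¬ (c₂ ≡ c₁) ⊎ ¬ (αpow (+ 2 ℤ.* u₂) ≃ αpow (+ 2 ℤ.* u₁)) →
    (suc n % 4 ≡ 1) × (c₂ ≡ ξ ⁻¹ + - ξ + - c₁)
      × (αpow (+ 2 ℤ.* u₂) ≃ αpow (+ 2 ℤ.* (u₁ ℤ.+ + (n / 4))))
  τγα-coset-collision ξ adm c₁ c₂ u₁ u₂ cosets≡ distinct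
    with ≡ᶜ⇒DihedralMultiple ω≢0 (τ ξ · γ c₁ · αpow (+ 2 ℤ.* u₁)) (τ ξ · γ c₂ · αpow (+ 2 ℤ.* u₂)) cosets≡
  ... | rotation _ _ e = ⊥-elim ([ (λ c₂≢c₁ → c₂≢c₁ c₂≡c₁) , (λ α≄α → α≄α α²ᵘ²≃α²ᵘ¹) ] distinct)
    where
      same = same-τ-rotation ξ c₁ c₂ (+ 2 ℤ.* u₁) (+ 2 ℤ.* u₂) adm e

      c₂≡c₁ : c₂ ≡ c₁
      c₂≡c₁ = ≡.sym (proj₁ same)

      α²ᵘ²≃α²ᵘ¹ : αpow (+ 2 ℤ.* u₂) ≃ αpow (+ 2 ℤ.* u₁)
      α²ᵘ²≃α²ᵘ¹ = αpow-≃ (+ 2 ℤ.* u₂) (+ 2 ℤ.* u₁) (≡.sym (proj₂ same))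
  ... | reflection _ _ e = q≡1mod4 , c₂≡ξ⁻¹-ξ-c₁ , αpow-≃ (+ 2 ℤ.* u₂) (+ 2 ℤ.* (u₁ ℤ.+ + K)) a₂≡ω^[2[u₁+K]]
    where
      K = n / 4
      reflected = same-τ-reflection ξ c₁ c₂ (+ 2 ℤ.* u₁) (+ 2 ℤ.* u₂) adm e
      a₁≡-a₂ = proj₁ reflected
      c₂≡ξ⁻¹-ξ-c₁ = proj₂ reflected

      q≡1mod4 : suc n % 4 ≡ 1
      q≡1mod4 = -1≡y²⇒q≡1mod4 (-1≡[x*y⁻¹]² (x^ℤz≢0 u₂ ω≢0) (begin
        ω ^ℤ u₁ * ω ^ℤ u₁            ≡⟨ x^ℤ[2u]≡[x^ℤu]² ω u₁ ⟨
        ω ^ℤ (+ 2 ℤ.* u₁)            ≡⟨ a₁≡-a₂ ⟩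
        - (ω ^ℤ (+ 2 ℤ.* u₂))        ≡⟨ ≡.cong -_ (x^ℤ[2u]≡[x^ℤu]² ω u₂) ⟩
        - (ω ^ℤ u₂ * ω ^ℤ u₂)        ∎))

      a₂≡ω^[2[u₁+K]] : ω ^ℤ (+ 2 ℤ.* u₂) ≡ ω ^ℤ (+ 2 ℤ.* (u₁ ℤ.+ + K))
      a₂≡ω^[2[u₁+K]] = ≡.sym (begin
        ω ^ℤ (+ 2 ℤ.* (u₁ ℤ.+ + K))           ≡⟨ ≡.cong (ω ^ℤ_) 2[u₁+K]≡2K+2u₁ ⟩
        ω ^ℤ (+ (2 ℕ.* K) ℤ.+ + 2 ℤ.* u₁)     ≡⟨ ^ℤ-ℕ+ (2 ℕ.* K) (+ 2 ℤ.* u₁) ω≢0 ⟩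
        ω ^ (2 ℕ.* K) * ω ^ℤ (+ 2 ℤ.* u₁)     ≡⟨ ≡.cong₂ _*_ (q≡1mod4⇒ω^[2K]≡-1 q≡1mod4) a₁≡-a₂ ⟩
        - 1# * - (ω ^ℤ (+ 2 ℤ.* u₂))          ≡⟨ solve 1 (λ a → :- con (+ 1) :* :- a := a) ≡.refl _ ⟩
        ω ^ℤ (+ 2 ℤ.* u₂)                     ∎)
        where
          2[u₁+K]≡2K+2u₁ : + 2 ℤ.* (u₁ ℤ.+ + K) ≡ + (2 ℕ.* K) ℤ.+ + 2 ℤ.* u₁
          2[u₁+K]≡2K+2u₁ = begin
            + 2 ℤ.* (u₁ ℤ.+ + K)           ≡⟨ ℤ.*-distribˡ-+ (+ 2) u₁ (+ K) ⟩
            + 2 ℤ.* u₁ ℤ.+ + 2 ℤ.* + K     ≡⟨ ℤ.+-comm (+ 2 ℤ.* u₁) (+ 2 ℤ.* + K) ⟩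
            + 2 ℤ.* + K ℤ.+ + 2 ℤ.* u₁     ≡⟨ ≡.cong (ℤ._+ + 2 ℤ.* u₁) (ℤ.pos-* 2 K) ⟨
            + (2 ℕ.* K) ℤ.+ + 2 ℤ.* u₁     ∎

  τγα-cosets⇒ξ₁ξ₂-square : suc n % 4 ≡ 1 → ∀ ξ₁ ξ₂ → Admissible ξ₁ → Admissible ξ₂ →
    ∀ c₁ c₂ (u₁ u₂ : ℤ) →
    τ ξ₁ · γ c₁ · αpow (+ 2 ℤ.* u₁) ≡ᶜ τ ξ₂ · γ c₂ · αpow (+ 2 ℤ.* u₂) →
    IsNonzeroSquare (ξ₁ * ξ₂)
  τγα-cosets⇒ξ₁ξ₂-square q≡1mod4 ξ₁ ξ₂ (ξ₁≢0 , _) (ξ₂≢0 , _) c₁ c₂ u₁ u₂ cosets≡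
    with ≡ᶜ⇒DihedralMultiple ω≢0 (τ ξ₁ · γ c₁ · αpow (+ 2 ℤ.* u₁)) (τ ξ₂ · γ c₂ · αpow (+ 2 ℤ.* u₂)) cosets≡
  ... | rotation {s} {w} s≢0 _ e = x*y≢0 ξ₁≢0 ξ₂≢0 , ξ₁ * w , (begin
    ξ₁ * ξ₂                  ≡⟨ ≡.cong (ξ₁ *_) ξ₂≡ξ₁w² ⟩
    ξ₁ * (ξ₁ * (w * w))      ≡⟨ solve 2 (λ ξ w → ξ :* (ξ :* (w :* w)) := ξ :* w :* (ξ :* w)) ≡.refl ξ₁ w ⟩
    ξ₁ * w * (ξ₁ * w)        ∎)
    where
      open Columns ξ₁ c₁ (+ 2 ℤ.* u₁) ξ₂ c₂ (+ 2 ℤ.* u₂) e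
      a₁ = ω ^ℤ (+ 2 ℤ.* u₁)
      a₂ = ω ^ℤ (+ 2 ℤ.* u₂)

      ξ₂≡ξ₁w² : ξ₂ ≡ ξ₁ * (w * w)
      ξ₂≡ξ₁w² = *-cancelʳ (x*y≢0 2≢0 (x*y≢0 s≢0 (x^ℤz≢0 (+ 2 ℤ.* u₂) ω≢0))) (begin
        ξ₂ * (2# * (s * a₂))
          ≡⟨ solve 3 (λ ξ s a → ξ :* (con (+ 2) :* (s :* a)) := s :* (con (+ 2) :* ξ :* a)) ≡.refl ξ₂ s a₂ ⟩
        s * (2# * ξ₂ * a₂)
          ≡⟨ column₀ (suc zero) ⟨
        2# * ξ₁ * a₁
          ≡⟨ ≡.cong (2# * ξ₁ *_) (*-identityˡ a₁) ⟨
        2# * ξ₁ * (1# * a₁)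
          ≡⟨ ≡.cong (2# * ξ₁ *_) (column₀ zero) ⟩
        2# * ξ₁ * (s * (w * w) * (1# * a₂))
          ≡⟨ solve 4 (λ ξ s w a → con (+ 2) :* ξ :* (s :* (w :* w) :* (con (+ 1) :* a))
                                  := ξ :* (w :* w) :* (con (+ 2) :* (s :* a))) ≡.refl ξ₁ s w a₂ ⟩
        ξ₁ * (w * w) * (2# * (s * a₂))
          ∎)
  ... | reflection {s} {w} {v} s≢0 wv≡1 e = x*y≢0 ξ₁≢0 ξ₂≢0 , i * w , (begin
    ξ₁ * ξ₂
      ≡⟨ *-identityʳ _ ⟨
    ξ₁ * ξ₂ * 1#
      ≡⟨ ≡.cong (ξ₁ * ξ₂ *_) (≡.trans (≡.cong₂ _*_ wv≡1 wv≡1) (*-identityˡ 1#)) ⟨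
    ξ₁ * ξ₂ * ((w * v) * (w * v))
      ≡⟨ solve 3 (λ x w v → x :* (w :* v :* (w :* v)) := x :* (v :* v) :* (w :* w)) ≡.refl (ξ₁ * ξ₂) w v ⟩
    ξ₁ * ξ₂ * (v * v) * (w * w)
      ≡⟨ ≡.cong (_* (w * w)) (≡.trans ξ₁ξ₂v²≡-1 (≡.sym i²≡-1)) ⟩
    i * i * (w * w)
      ≡⟨ solve 2 (λ i w → i :* i :* (w :* w) := i :* w :* (i :* w)) ≡.refl i w ⟩
    i * w * (i * w)
      ∎)
    where
      open Columns ξ₁ c₁ (+ 2 ℤ.* u₁) ξ₂ c₂ (+ 2 ℤ.* u₂) e
      a₁ = ω ^ℤ (+ 2 ℤ.* u₁)
      a₂ = ω ^ℤ (+ 2 ℤ.* u₂)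
      K = n / 4
      i = ω ^ K

      i²≡-1 : i * i ≡ - 1#
      i²≡-1 = begin
        ω ^ K * ω ^ K          ≡⟨ ^-homo-* ω K K ⟨
        ω ^ (K ℕ.+ K)          ≡⟨ ≡.cong (λ m → ω ^ (K ℕ.+ m)) (ℕ.+-identityʳ K) ⟨
        ω ^ (2 ℕ.* K)          ≡⟨ q≡1mod4⇒ω^[2K]≡-1 q≡1mod4 ⟩
        - 1#                   ∎

      ξ₁ξ₂v²≡-1 : ξ₁ * ξ₂ * (v * v) ≡ - 1#
      ξ₁ξ₂v²≡-1 = *-cancelʳ (x*y≢0 2≢0 (x*y≢0 s≢0 (x*y≢0 ξ₂≢0 (x^ℤz≢0 (+ 2 ℤ.* u₂) ω≢0)))) (begin
        ξ₁ * ξ₂ * (v * v) * (2# * (s * (ξ₂ * a₂)))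
          ≡⟨ solve 5 (λ x y v s a → x :* y :* (v :* v) :* (con (+ 2) :* (s :* (y :* a)))
                                    := con (+ 2) :* x :* (s :* (v :* v) :* (y :* y :* a))) ≡.refl ξ₁ ξ₂ v s a₂ ⟩
        2# * ξ₁ * (s * (v * v) * (ξ₂ * ξ₂ * a₂))   ≡⟨ ≡.cong (2# * ξ₁ *_) (column₀ zero) ⟨
        2# * ξ₁ * (1# * a₁)                        ≡⟨ ≡.cong (2# * ξ₁ *_) (*-identityˡ a₁) ⟩
        2# * ξ₁ * a₁                               ≡⟨ column₀ (suc zero) ⟩
        - s * (2# * ξ₂ * a₂)
          ≡⟨ solve 3 (λ y s a → :- s :* (con (+ 2) :* y :* a) := :- con (+ 1) :* (con (+ 2) :* (s :* (y :* a))))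
                     ≡.refl ξ₂ s a₂ ⟩
        - 1# * (2# * (s * (ξ₂ * a₂)))              ∎)

open import Data.Nat using (_^_)

lemma2p9 : (p f q : ℕ) → Prime p → p % 2 ≡ 1 → q ≡ p ^ f → 5 < q →
    (F : FiniteField q) (ω : FiniteField.Carrier F) →
    let open Setup F ω in
    IsPrimitive →
    -- (i)
    (∀ c₁ c₂ → γ c₁ ≡ᶜ γ c₂ → c₁ ≡ c₂)
    -- (ii)
    × (∀ ξ → Admissible ξ → ∀ c₁ c₂ (u : ℤ) →
         ¬ (γ c₁ ≡ᶜ τ ξ · γ c₂ · αpow (+ 2 ℤ.* u)))
    -- (iii)
    × (∀ ξ → Admissible ξ → ∀ c₁ c₂ (u₁ u₂ : ℤ) →
         τ ξ · γ c₁ · αpow (+ 2 ℤ.* u₁) ≡ᶜ τ ξ · γ c₂ · αpow (+ 2 ℤ.* u₂) →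
         ¬ (c₂ ≡ c₁) ⊎ ¬ (αpow (+ 2 ℤ.* u₂) ≃ αpow (+ 2 ℤ.* u₁)) →
         (q % 4 ≡ 1)
         × (c₂ ≡ ξ ⁻¹ + - ξ + - c₁)
         × (αpow (+ 2 ℤ.* u₂) ≃ αpow (+ 2 ℤ.* (u₁ ℤ.+ + ((q ∸ 1) / 4)))))
    -- (iv)
    × (q % 4 ≡ 1 → ∀ ξ₁ ξ₂ → Admissible ξ₁ → Admissible ξ₂ → ¬ (ξ₁ ≡ ξ₂) →
         ∀ c₁ c₂ (u₁ u₂ : ℤ) →
         τ ξ₁ · γ c₁ · αpow (+ 2 ℤ.* u₁) ≡ᶜ τ ξ₂ · γ c₂ · αpow (+ 2 ℤ.* u₂) →
         IsNonzeroSquare (ξ₁ * ξ₂))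
-- In (iv) the
-- claim also holds for ξ₁ ≡ ξ₂.
lemma2p9 p f (suc n) _ p%2≡1 q≡p^f (s≤s 5≤n) F ω isPrimitive =
  γ-coset-injective ,
  γ≢ᶜτγα ,
  τγα-coset-collision ,
  λ q≡1mod4 ξ₁ ξ₂ adm₁ adm₂ _ → τγα-cosets⇒ξ₁ξ₂-square q≡1mod4 ξ₁ ξ₂ adm₁ adm₂
  where
    h = suc n / 2

    n≡h+h : n ≡ h ℕ.+ h
    n≡h+h = [1+n]%2≡1⇒n≡h+h (≡.trans (≡.cong (_% 2) q≡p^f) (m%2≡1⇒m^k%2≡1 f p%2≡1))

    0<h : 0 < h
    0<h = ℕ.n≢0⇒n>0 λ h≡0 → ℕ.<⇒≱ (s≤s z≤n) (≡.subst (5 ≤_) (≡.trans n≡h+h (≡.cong₂ ℕ._+_ h≡0 h≡0)) 5≤n)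

    open CosetsOfH₀ F ω isPrimitive n≡h+h 0<h
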